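{- Let $q=p^n$ with $p$ prime and $n\ge 2$, and let $m$ be an integer with $1\le m\le p-1$. Let $V[x]$ be the $\mathbb{F}_q$-vector space of polynomials $f\in\mathbb{F}_q[x]$ of degree at most $q-2$ with $f(0)=0$, and let $A:V[x]\to V[x]$ be the linear map $A(f)(x)=f(x+1)-f(1)$. Then $\ker(A-I)^m$ is spanned by the polynomials $x^j(x^p-x)^i$ for $j=0,1,\ldots,m-1$ and $i=1,2,\ldots,p^{n-1}-1$, together with the monomials $x^k$ for $k=1,2,\ldots,m$.
   Context: Polynomials in $V[x]$ are formal polynomials; $f(x+1)$ denotes formal substitution; $I$ is the identity map of $V[x]$. -}

module Defs where

open import Level using (Level; _⊔_) renaming (suc to lsuc)
open import Data.Nat using (ℕ; zero; suc; _∸_; _≤_; _^_)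
open import Data.Fin using (Fin)
open import Data.List using (List; []; _∷_; map; foldr; length; lookup; concatMap; upTo; _++_)
open import Data.Product using (Σ; _×_)
open import Relation.Nullary using (¬_)
open import Algebra.Bundles using (CommutativeRing)
open import Function.Bundles using (Bijection)
import Relation.Binary.PropositionalEquality as P

record Field (c ℓ : Level) : Set (lsuc (c ⊔ ℓ)) where
  field
    commutativeRing : CommutativeRing c ℓ
  open CommutativeRing commutativeRing public
  field
    0≉1     : ¬ (0# ≈ 1#)
    inverse : ∀ x → ¬ (x ≈ 0#) → Σ Carrier (λ y → x * y ≈ 1#)

HasCardinality : ∀ {c ℓ} → Field c ℓ → ℕ → Set (c ⊔ ℓ)
HasCardinality F q = Bijection (Field.setoid F) (P.setoid (Fin q))

-- Formal polynomials over a commutative ring, as coefficient lists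
-- (lowest degree first).
module Poly {c ℓ} (R : CommutativeRing c ℓ) where
  open CommutativeRing R

  Pol : Set c
  Pol = List Carrier

  coeff : Pol → ℕ → Carrier
  coeff []      _       = 0#
  coeff (a ∷ f) zero    = a
  coeff (a ∷ f) (suc k) = coeff f k

  _≃_ : Pol → Pol → Set ℓ
  f ≃ g = ∀ k → coeff f k ≈ coeff g k

  _⊕_ : Pol → Pol → Pol
  []      ⊕ g       = g
  (a ∷ f) ⊕ []      = a ∷ f
  (a ∷ f) ⊕ (b ∷ g) = (a + b) ∷ (f ⊕ g)

  scale : Carrier → Pol → Pol
  scale a = map (a *_)

  neg : Pol → Pol
  neg = scale (- 1#)

  _⊖_ : Pol → Pol → Pol
  f ⊖ g = f ⊕ neg g

  _⊗_ : Pol → Pol → Pol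
  []      ⊗ g = []
  (a ∷ f) ⊗ g = scale a g ⊕ (0# ∷ (f ⊗ g))

  const : Carrier → Pol
  const a = a ∷ []

  X : Pol
  X = 0# ∷ 1# ∷ []

  pow : Pol → ℕ → Pol
  pow f zero    = const 1#
  pow f (suc k) = f ⊗ pow f k

  -- formal substitution f(x) ↦ f(x+1) (Horner scheme)
  shift : Pol → Pol
  shift []      = []
  shift (a ∷ f) = const a ⊕ ((1# ∷ 1# ∷ []) ⊗ shift f)

  eval1 : Pol → Carrier
  eval1 = foldr _+_ 0#

  opA : Pol → Pol
  opA f = shift f ⊖ const (eval1 f)

  opAmI : Pol → Pol
  opAmI f = opA f ⊖ f

  iter : ℕ → (Pol → Pol) → Pol → Pol
  iter zero    g f = f
  iter (suc k) g f = g (iter k g f)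

  InV : ℕ → Pol → Set ℓ
  InV q f = (coeff f 0 ≈ 0#) × (∀ k → q ∸ 1 ≤ k → coeff f k ≈ 0#)

  InKer : ℕ → ℕ → Pol → Set ℓ
  InKer q m f = InV q f × (iter m opAmI f ≃ [])

  linComb : (gs : List Pol) → (Fin (length gs) → Carrier) → Pol
  linComb []       c = []
  linComb (g ∷ gs) c = scale (c Fin.zero) g ⊕ linComb gs (λ i → c (Fin.suc i))
    where import Data.Fin as Fin

  InSpan : List Pol → Pol → Set (c ⊔ ℓ)
  InSpan gs f = Σ (Fin (length gs) → Carrier) (λ c → f ≃ linComb gs c)

  generators : (p n m : ℕ) → List Pol
  generators p n m =
    concatMap (λ j → map (λ i → pow X j ⊗ pow (pow X p ⊖ X) (suc i))
                         (upTo (p ^ (n ∸ 1) ∸ 1)))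
              (upTo m)
    ++ map (λ k → pow X (suc k)) (upTo m)

{-# OPTIONS --safe #-}
-- In characteristic p the polynomial T = x^p - x satisfies T(x + 1) = T(x) and T(1) = 0,
-- so (A - I)(h T^i) = (Δh) T^i where Δh = h(x + 1) - h(x).  Since Δ lowers degrees,
-- x^j T^i lies in ker (A - I)^m for j < m; so does x^k for k ≤ m, because A - I lowers
-- degrees and keeps f(0) = 0.  Conversely, let f ≠ 0 in the kernel have degree D.  If
-- D ≤ m, or if D mod p < m, some generator has degree D and can be subtracted from f.
-- Otherwise (A - I)^m multiplies the top coefficient of f by D (D - 1) ⋯ (D - m + 1),
-- which is prime to p, so that coefficient must vanish.
-- That the field has characteristic p follows from q · 1 = 0: translating by 1 permutes
-- the field and so does not change the sum of its elements.
module Submission where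

open import Defs
open import Algebra.Bundles using (CommutativeRing)

module Arithmetic where

  open import Data.Nat
  open import Data.Nat.Properties
  open import Data.Nat.Divisibility
  open import Data.Nat.DivMod
  open import Data.Nat.Primality using (Prime; euclidsLemma; prime⇒nonZero; ¬prime[1])
  open import Data.Nat.Combinatorics using (_C_; k![n∸k]!∣n!)
  open import Data.Nat.Combinatorics.Specification using (nCk≡n!/k![n-k]!)
  open import Data.Sum using (inj₁; inj₂)
  open import Relation.Nullary using (¬_; contradiction)
  open import Relation.Binary.PropositionalEquality

  rising : ℕ → ℕ → ℕ
  rising a zero    = 1
  rising a (suc t) = a * rising (suc a) t

  n∣n! : ∀ n .{{_ : NonZero n}} → n ∣ n !
  n∣n! (suc n) = m∣m*n (n !)

  module _ {p} (prime : Prime p) where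

    private instance
      p≢0 : NonZero p
      p≢0 = prime⇒nonZero prime

    ¬p∣1 : ¬ p ∣ 1
    ¬p∣1 p∣1 = ¬prime[1] (subst Prime (∣1⇒≡1 p∣1) prime)

    ¬p∣k! : ∀ k → k < p → ¬ p ∣ k !
    ¬p∣k! zero    _   = ¬p∣1
    ¬p∣k! (suc k) k<p p∣k! with euclidsLemma (suc k) (k !) prime p∣k!
    ... | inj₁ p∣k = <⇒≱ k<p (∣⇒≤ p∣k)
    ... | inj₂ p∣k = ¬p∣k! k (<-trans (n<1+n k) k<p) p∣k

    p∣pCk : ∀ {k} → 0 < k → k < p → p ∣ p C k
    p∣pCk {k} 0<k k<p = subst (p ∣_) (sym (nCk≡n!/k![n-k]! k≤p)) p∣quotient
      where
      k≤p : k ≤ p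
      k≤p = <⇒≤ k<p
      instance
        d≢0 : NonZero (k ! * (p ∸ k) !)
        d≢0 = k !* (p ∸ k) !≢0
      p∣quotient : p ∣ p ! / (k ! * (p ∸ k) !)
      p∣quotient with euclidsLemma _ _ prime
                        (subst (p ∣_) (sym (m/n*n≡m (k![n∸k]!∣n! k≤p))) (n∣n! p))
      ... | inj₁ p∣q = p∣q
      ... | inj₂ p∣d with euclidsLemma (k !) ((p ∸ k) !) prime p∣d
      ...   | inj₁ p∣k! = contradiction p∣k! (¬p∣k! k k<p)
      ...   | inj₂ p∣l! = contradiction p∣l! (¬p∣k! (p ∸ k) (∸-monoʳ-< 0<k k≤p))

    -- The largest multiple of p up to D is D - D % p, so no multiple of p lies strictly above it.
    ¬p∣-above-residue : ∀ {D x} → x ≤ D → D ∸ x < D % p → ¬ p ∣ x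
    ¬p∣-above-residue {D} {x} x≤D D∸x<r (divides c x≡cp) = <-irrefl (sym D%p≡D∸x) D∸x<r
      where
      D%p≡D∸x : D % p ≡ D ∸ x
      D%p≡D∸x = begin
        D % p                   ≡⟨ cong (_% p) (sym (m∸n+n≡m x≤D)) ⟩
        (D ∸ x + x) % p         ≡⟨ cong (λ y → (D ∸ x + y) % p) x≡cp ⟩
        (D ∸ x + c * p) % p     ≡⟨ [m+kn]%n≡m%n (D ∸ x) c p ⟩
        (D ∸ x) % p             ≡⟨ m<n⇒m%n≡m (<-trans D∸x<r (m%n<n D p)) ⟩
        D ∸ x                   ∎
        where open ≡-Reasoning

    ¬p∣rising : ∀ a t → (∀ x → a ≤ x → x < t + a → ¬ p ∣ x) → ¬ p ∣ rising a t
    ¬p∣rising a zero    _     = ¬p∣1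
    ¬p∣rising a (suc t) ¬p∣x p∣a*r with euclidsLemma a (rising (suc a) t) prime p∣a*r
    ... | inj₁ p∣a = ¬p∣x a ≤-refl (m<n+m a z<s) p∣a
    ... | inj₂ p∣r = ¬p∣rising (suc a) t
          (λ x a<x x<t+1+a → ¬p∣x x (<⇒≤ a<x) (≤-trans x<t+1+a (≤-reflexive (+-suc t a))))
          p∣r

    -- The factors of rising (2 + s) m are the m integers ending at m + 1 + s.
    ¬p∣rising-residue : ∀ m s → m ≤ (m + suc s) % p → ¬ p ∣ rising (2 + s) m
    ¬p∣rising-residue zero     s _   = ¬p∣1
    ¬p∣rising-residue m@(suc _) s m≤r = ¬p∣rising (2 + s) m λ x 2+s≤x x<m+2+s →
      ¬p∣-above-residue (x≤D x<m+2+s) (≤-trans (D∸x<m 2+s≤x) m≤r)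
      where
      x≤D : ∀ {x} → x < m + (2 + s) → x ≤ m + suc s
      x≤D x<m+2+s = ≤-pred (≤-trans x<m+2+s (≤-reflexive (+-suc m (suc s))))
      D∸x<m : ∀ {x} → 2 + s ≤ x → m + suc s ∸ x < m
      D∸x<m {x} 2+s≤x = m<n+o⇒m∸n<o (m + suc s) x
        (≤-trans (≤-reflexive (cong suc (+-comm m (suc s)))) (+-monoˡ-≤ m 2+s≤x))

  <⇒≤∸1 : ∀ {m n} → m < n → m ≤ n ∸ 1
  <⇒≤∸1 (s≤s m≤n) = m≤n

  <∸1⇒suc< : ∀ {m n} → m < n ∸ 1 → suc m < n
  <∸1⇒suc< {n = suc _} m<n = s≤s m<n

  ≤∸1⇒< : ∀ {m n} .{{_ : NonZero n}} → m ≤ n ∸ 1 → m < n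
  ≤∸1⇒< {n = suc _} m≤n = s≤s m≤n

module PolynomialAlgebra {c ℓ} (R : CommutativeRing c ℓ) where

  open Arithmetic using (rising; p∣pCk)
  open import Data.Nat.Combinatorics using (_C_; nCk+nC[k+1]≡[n+1]C[k+1]; nCn≡1)
  open import Data.Nat.Combinatorics.Specification using (k>n⇒nCk≡0)
  open import Data.Nat.Divisibility using (_∣_; divides)
  open import Data.Nat.Primality using (Prime; ¬prime[0])
  open import Relation.Binary.Definitions using (tri<; tri≈; tri>)
  open import Relation.Nullary using (¬_; contradiction)
  open import Level using (_⊔_)
  open import Data.Fin as Fin using (Fin)
  open import Data.List.Relation.Unary.Any using (here; there)
  open import Data.List.Membership.Propositional using (_∈_)
  open import Data.Nat as ℕ using (ℕ; zero; suc; _≤_; _<_; z≤n; s≤s)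
  import Data.Nat.Properties as ℕ
  open import Data.Product using (_,_)
  open import Data.Sum using (inj₁; inj₂)
  import Relation.Binary.PropositionalEquality as ≡
  open import Data.List using (List; []; _∷_; length)
  open import Relation.Binary.Bundles using (Setoid)
  import Relation.Binary.Reasoning.Setoid as SetoidReasoning

  open CommutativeRing R
  open Poly R
  module ≈-Reasoning = SetoidReasoning setoid
  open import Algebra.Properties.Ring ring using (-1*x≈-x; -0#≈0#; -‿distribʳ-*)
  open import Algebra.Properties.AbelianGroup +-abelianGroup using (⁻¹-∙-comm)
  open import Algebra.Properties.CommutativeSemigroup +-commutativeSemigroup
    using () renaming (interchange to +-interchange)
  open import Algebra.Properties.Semiring.Mult semiring using (_×_; ×1-homo-*; ×-homo-+)
  open import Algebra.Solver.Ring.NaturalCoefficients.Default commutativeSemiring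
    using (solve; _:+_; _:*_; _:=_; con)

  -- Unlike the function type _≃_ of Defs, this record lets Agda infer both polynomials.
  infix 4 _≋_
  record _≋_ (f g : Pol) : Set ℓ where
    constructor mk≋
    field at : ∀ k → coeff f k ≈ coeff g k
  open _≋_ public

  ≋-refl : ∀ {f} → f ≋ f
  ≋-refl = mk≋ λ _ → refl

  ≋-sym : ∀ {f g} → f ≋ g → g ≋ f
  ≋-sym f≋g = mk≋ λ k → sym (at f≋g k)

  ≋-trans : ∀ {f g h} → f ≋ g → g ≋ h → f ≋ h
  ≋-trans f≋g g≋h = mk≋ λ k → trans (at f≋g k) (at g≋h k)

  ≋-setoid : Setoid c ℓ
  ≋-setoid = record
    { Carrier = Pol ; _≈_ = _≋_
    ; isEquivalence = record { refl = ≋-refl ; sym = ≋-sym ; trans = ≋-trans } }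

  module ≋-Reasoning = SetoidReasoning ≋-setoid

  IsZero : Pol → Set ℓ
  IsZero f = f ≋ []

  ∷-cong : ∀ {a b f g} → a ≈ b → f ≋ g → (a ∷ f) ≋ (b ∷ g)
  ∷-cong a≈b f≋g = mk≋ λ where
      zero    → a≈b
      (suc k) → at f≋g k

  tail-cong : ∀ {a b f g} → (a ∷ f) ≋ (b ∷ g) → f ≋ g
  tail-cong e = mk≋ λ k → at e (suc k)

  IsZero-tail : ∀ {a f} → IsZero (a ∷ f) → IsZero f
  IsZero-tail f≋0 = mk≋ λ k → at f≋0 (suc k)

  IsZero-0∷ : ∀ {h} → IsZero h → IsZero (0# ∷ h)
  IsZero-0∷ h≋0 = mk≋ λ where
      zero    → refl
      (suc k) → at h≋0 k

  IsZero-const : ∀ {a} → a ≈ 0# → IsZero (const a)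
  IsZero-const a≈0 = mk≋ λ where
      zero    → a≈0
      (suc k) → refl

  coeff-⊕ : ∀ f g k → coeff (f ⊕ g) k ≈ coeff f k + coeff g k
  coeff-⊕ []      g       k       = sym (+-identityˡ _)
  coeff-⊕ (a ∷ f) []      zero    = sym (+-identityʳ _)
  coeff-⊕ (a ∷ f) []      (suc k) = sym (+-identityʳ _)
  coeff-⊕ (a ∷ f) (b ∷ g) zero    = refl
  coeff-⊕ (a ∷ f) (b ∷ g) (suc k) = coeff-⊕ f g k

  coeff-scale : ∀ a f k → coeff (scale a f) k ≈ a * coeff f k
  coeff-scale a []      k       = sym (zeroʳ a)
  coeff-scale a (b ∷ f) zero    = refl
  coeff-scale a (b ∷ f) (suc k) = coeff-scale a f k

  coeff-⊖ : ∀ f g k → coeff (f ⊖ g) k ≈ coeff f k - coeff g k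
  coeff-⊖ f g k = trans (coeff-⊕ f (neg g) k)
    (+-congˡ (trans (coeff-scale (- 1#) g k) (-1*x≈-x _)))

  coeff-∷⊗ : ∀ a f g k → coeff ((a ∷ f) ⊗ g) k ≈ a * coeff g k + coeff (0# ∷ (f ⊗ g)) k
  coeff-∷⊗ a f g k = trans (coeff-⊕ (scale a g) (0# ∷ (f ⊗ g)) k) (+-congʳ (coeff-scale a g k))

  coeff₀-⊗ : ∀ f g → coeff (f ⊗ g) 0 ≈ coeff f 0 * coeff g 0
  coeff₀-⊗ []      g = sym (zeroˡ _)
  coeff₀-⊗ (a ∷ f) g = trans (coeff-∷⊗ a f g 0) (+-identityʳ _)

  coeff-suc-∷⊗ : ∀ a f g k → coeff ((a ∷ f) ⊗ g) (suc k) ≈ a * coeff g (suc k) + coeff (f ⊗ g) k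
  coeff-suc-∷⊗ a f g k = coeff-∷⊗ a f g (suc k)


  ⊕-cong : ∀ {f f′ g g′} → f ≋ f′ → g ≋ g′ → (f ⊕ g) ≋ (f′ ⊕ g′)
  ⊕-cong {f} {f′} {g} {g′} f≋f′ g≋g′ = mk≋ λ k → begin
    coeff (f ⊕ g) k          ≈⟨ coeff-⊕ f g k ⟩
    coeff f k + coeff g k    ≈⟨ +-cong (at f≋f′ k) (at g≋g′ k) ⟩
    coeff f′ k + coeff g′ k  ≈⟨ coeff-⊕ f′ g′ k ⟨
    coeff (f′ ⊕ g′) k        ∎
    where open ≈-Reasoning

  scale-cong : ∀ {a a′ f f′} → a ≈ a′ → f ≋ f′ → scale a f ≋ scale a′ f′
  scale-cong {a} {a′} {f} {f′} a≈a′ f≋f′ = mk≋ λ k →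
    trans (coeff-scale a f k) (trans (*-cong a≈a′ (at f≋f′ k)) (sym (coeff-scale a′ f′ k)))

  scale-assoc : ∀ a b f → scale (a * b) f ≋ scale a (scale b f)
  scale-assoc a b f = mk≋ λ k → begin
    coeff (scale (a * b) f) k     ≈⟨ coeff-scale (a * b) f k ⟩
    (a * b) * coeff f k           ≈⟨ *-assoc a b _ ⟩
    a * (b * coeff f k)           ≈⟨ *-congˡ (coeff-scale b f k) ⟨
    a * coeff (scale b f) k       ≈⟨ coeff-scale a (scale b f) k ⟨
    coeff (scale a (scale b f)) k ∎
    where open ≈-Reasoning

  scale-distrib-⊕ : ∀ a f g → scale a (f ⊕ g) ≋ (scale a f ⊕ scale a g)
  scale-distrib-⊕ a f g = mk≋ λ k → begin
    coeff (scale a (f ⊕ g)) k                 ≈⟨ coeff-scale a (f ⊕ g) k ⟩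
    a * coeff (f ⊕ g) k                       ≈⟨ *-congˡ (coeff-⊕ f g k) ⟩
    a * (coeff f k + coeff g k)               ≈⟨ distribˡ a _ _ ⟩
    a * coeff f k + a * coeff g k             ≈⟨ +-cong (coeff-scale a f k) (coeff-scale a g k) ⟨
    coeff (scale a f) k + coeff (scale a g) k ≈⟨ coeff-⊕ (scale a f) (scale a g) k ⟨
    coeff (scale a f ⊕ scale a g) k           ∎
    where open ≈-Reasoning

  scale-distribʳ-+ : ∀ a b f → scale (a + b) f ≋ (scale a f ⊕ scale b f)
  scale-distribʳ-+ a b f = mk≋ λ k → begin
    coeff (scale (a + b) f) k                 ≈⟨ coeff-scale (a + b) f k ⟩
    (a + b) * coeff f k                       ≈⟨ distribʳ _ a b ⟩
    a * coeff f k + b * coeff f k             ≈⟨ +-cong (coeff-scale a f k) (coeff-scale b f k) ⟨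
    coeff (scale a f) k + coeff (scale b f) k ≈⟨ coeff-⊕ (scale a f) (scale b f) k ⟨
    coeff (scale a f ⊕ scale b f) k           ∎
    where open ≈-Reasoning

  ⊕-interchange : ∀ f g h u → ((f ⊕ g) ⊕ (h ⊕ u)) ≋ ((f ⊕ h) ⊕ (g ⊕ u))
  ⊕-interchange f g h u = mk≋ λ k → begin
    coeff ((f ⊕ g) ⊕ (h ⊕ u)) k                       ≈⟨ coeff-⊕ (f ⊕ g) (h ⊕ u) k ⟩
    coeff (f ⊕ g) k + coeff (h ⊕ u) k                 ≈⟨ +-cong (coeff-⊕ f g k) (coeff-⊕ h u k) ⟩
    (coeff f k + coeff g k) + (coeff h k + coeff u k) ≈⟨ +-interchange _ _ _ _ ⟩
    (coeff f k + coeff h k) + (coeff g k + coeff u k) ≈⟨ +-cong (coeff-⊕ f h k) (coeff-⊕ g u k) ⟨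
    coeff (f ⊕ h) k + coeff (g ⊕ u) k                 ≈⟨ coeff-⊕ (f ⊕ h) (g ⊕ u) k ⟨
    coeff ((f ⊕ h) ⊕ (g ⊕ u)) k                       ∎
    where open ≈-Reasoning

  ⊖-cong : ∀ {f f′ g g′} → f ≋ f′ → g ≋ g′ → (f ⊖ g) ≋ (f′ ⊖ g′)
  ⊖-cong f≋f′ g≋g′ = ⊕-cong f≋f′ (scale-cong refl g≋g′)

  ⊖-⊕-cancel : ∀ f h → ((f ⊖ h) ⊕ h) ≋ f
  ⊖-⊕-cancel f h = mk≋ λ k → begin
    coeff ((f ⊖ h) ⊕ h) k               ≈⟨ coeff-⊕ (f ⊖ h) h k ⟩
    coeff (f ⊖ h) k + coeff h k         ≈⟨ +-congʳ (coeff-⊖ f h k) ⟩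
    (coeff f k - coeff h k) + coeff h k ≈⟨ +-assoc _ _ _ ⟩
    coeff f k + (- coeff h k + coeff h k) ≈⟨ +-congˡ (-‿inverseˡ _) ⟩
    coeff f k + 0#                      ≈⟨ +-identityʳ _ ⟩
    coeff f k                           ∎
    where open ≈-Reasoning

  ⊕-identityˡ : ∀ {h} f → IsZero h → (h ⊕ f) ≋ f
  ⊕-identityˡ {h} f h≋0 = mk≋ λ k →
    trans (coeff-⊕ h f k) (trans (+-congʳ (at h≋0 k)) (+-identityˡ _))

  ⊕-identityʳ : ∀ f {h} → IsZero h → (f ⊕ h) ≋ f
  ⊕-identityʳ f {h} h≋0 = mk≋ λ k →
    trans (coeff-⊕ f h k) (trans (+-congˡ (at h≋0 k)) (+-identityʳ _))

  scale-by-0 : ∀ f → IsZero (scale 0# f)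
  scale-by-0 f = mk≋ λ k → trans (coeff-scale 0# f k) (zeroˡ _)

  scale-zero : ∀ a {f} → IsZero f → IsZero (scale a f)
  scale-zero a f≋0 = scale-cong refl f≋0

  ⊗-zeroˡ : ∀ f g → IsZero f → IsZero (f ⊗ g)
  ⊗-zeroˡ []      g _   = ≋-refl
  ⊗-zeroˡ (a ∷ f) g f≋0 = mk≋ λ where
      zero    → trans (coeff₀-⊗ (a ∷ f) g) (a0*_ (coeff g 0))
      (suc k) → trans (coeff-suc-∷⊗ a f g k)
                  (trans (+-cong (a0*_ (coeff g (suc k))) (at (⊗-zeroˡ f g (IsZero-tail f≋0)) k))
                         (+-identityʳ _))
    where
    a0*_ : ∀ x → a * x ≈ 0#
    a0* x = trans (*-congʳ (at f≋0 0)) (zeroˡ x)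

  ⊗-congˡ : ∀ {f f′} g → f ≋ f′ → (f ⊗ g) ≋ (f′ ⊗ g)
  ⊗-congˡ {[]}    {[]}      g _    = ≋-refl
  ⊗-congˡ {[]}    {a′ ∷ f′} g f≋f′ = ≋-sym (⊗-zeroˡ (a′ ∷ f′) g (≋-sym f≋f′))
  ⊗-congˡ {a ∷ f} {[]}      g f≋f′ = ⊗-zeroˡ (a ∷ f) g f≋f′
  ⊗-congˡ {a ∷ f} {a′ ∷ f′} g f≋f′ = mk≋ λ where
      zero    → trans (coeff₀-⊗ (a ∷ f) g) (trans (*-congʳ (at f≋f′ 0)) (sym (coeff₀-⊗ (a′ ∷ f′) g)))
      (suc k) → trans (coeff-suc-∷⊗ a f g k)
                  (trans (+-cong (*-congʳ (at f≋f′ 0)) (at (⊗-congˡ g (tail-cong f≋f′)) k))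
                         (sym (coeff-suc-∷⊗ a′ f′ g k)))

  ⊗-congʳ : ∀ f {g g′} → g ≋ g′ → (f ⊗ g) ≋ (f ⊗ g′)
  ⊗-congʳ []      _    = ≋-refl
  ⊗-congʳ (a ∷ f) {g} {g′} g≋g′ = mk≋ λ where
      zero    → trans (coeff₀-⊗ (a ∷ f) g) (trans (*-congˡ (at g≋g′ 0)) (sym (coeff₀-⊗ (a ∷ f) g′)))
      (suc k) → trans (coeff-suc-∷⊗ a f g k)
                  (trans (+-cong (*-congˡ (at g≋g′ (suc k))) (at (⊗-congʳ f g≋g′) k))
                         (sym (coeff-suc-∷⊗ a f g′ k)))

  ⊗-cong : ∀ {f f′ g g′} → f ≋ f′ → g ≋ g′ → (f ⊗ g) ≋ (f′ ⊗ g′)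
  ⊗-cong {f′ = f′} {g} f≋f′ g≋g′ = ≋-trans (⊗-congˡ g f≋f′) (⊗-congʳ f′ g≋g′)

  pow-cong : ∀ {f g} k → f ≋ g → pow f k ≋ pow g k
  pow-cong zero    _   = ≋-refl
  pow-cong (suc k) f≋g = ⊗-cong f≋g (pow-cong k f≋g)

  ⊗-distribʳ-⊕ : ∀ f f′ g → ((f ⊕ f′) ⊗ g) ≋ ((f ⊗ g) ⊕ (f′ ⊗ g))
  ⊗-distribʳ-⊕ []      f′       g = ≋-refl
  ⊗-distribʳ-⊕ (a ∷ f) []       g = ≋-sym (⊕-identityʳ _ ≋-refl)
  ⊗-distribʳ-⊕ (a ∷ f) (b ∷ f′) g = mk≋ λ where
      zero → begin
        coeff (((a ∷ f) ⊕ (b ∷ f′)) ⊗ g) 0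
          ≈⟨ coeff₀-⊗ ((a + b) ∷ (f ⊕ f′)) g ⟩
        (a + b) * coeff g 0
          ≈⟨ distribʳ _ a b ⟩
        a * coeff g 0 + b * coeff g 0
          ≈⟨ +-cong (coeff₀-⊗ (a ∷ f) g) (coeff₀-⊗ (b ∷ f′) g) ⟨
        coeff ((a ∷ f) ⊗ g) 0 + coeff ((b ∷ f′) ⊗ g) 0
          ≈⟨ coeff-⊕ ((a ∷ f) ⊗ g) ((b ∷ f′) ⊗ g) 0 ⟨
        coeff (((a ∷ f) ⊗ g) ⊕ ((b ∷ f′) ⊗ g)) 0
          ∎
      (suc k) → begin
        coeff (((a ∷ f) ⊕ (b ∷ f′)) ⊗ g) (suc k)
          ≈⟨ coeff-suc-∷⊗ (a + b) (f ⊕ f′) g k ⟩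
        (a + b) * coeff g (suc k) + coeff ((f ⊕ f′) ⊗ g) k
          ≈⟨ +-congˡ (trans (at (⊗-distribʳ-⊕ f f′ g) k) (coeff-⊕ (f ⊗ g) (f′ ⊗ g) k)) ⟩
        (a + b) * coeff g (suc k) + (coeff (f ⊗ g) k + coeff (f′ ⊗ g) k)
          ≈⟨ regroup a b (coeff g (suc k)) _ _ ⟩
        (a * coeff g (suc k) + coeff (f ⊗ g) k) + (b * coeff g (suc k) + coeff (f′ ⊗ g) k)
          ≈⟨ +-cong (coeff-suc-∷⊗ a f g k) (coeff-suc-∷⊗ b f′ g k) ⟨
        coeff ((a ∷ f) ⊗ g) (suc k) + coeff ((b ∷ f′) ⊗ g) (suc k)
          ≈⟨ coeff-⊕ ((a ∷ f) ⊗ g) ((b ∷ f′) ⊗ g) (suc k) ⟨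
        coeff (((a ∷ f) ⊗ g) ⊕ ((b ∷ f′) ⊗ g)) (suc k)
          ∎
    where
    open ≈-Reasoning
    regroup : ∀ a b x y z → (a + b) * x + (y + z) ≈ (a * x + y) + (b * x + z)
    regroup = solve 5 (λ a b x y z → (a :+ b) :* x :+ (y :+ z) := (a :* x :+ y) :+ (b :* x :+ z)) refl

  scale-⊗ : ∀ a f g → (scale a f ⊗ g) ≋ scale a (f ⊗ g)
  scale-⊗ a []      g = ≋-refl
  scale-⊗ a (b ∷ f) g = mk≋ λ where
      zero    → trans (coeff₀-⊗ (scale a (b ∷ f)) g)
                  (trans (*-assoc a b _) (sym (trans (coeff-scale a ((b ∷ f) ⊗ g) 0)
                                                     (*-congˡ (coeff₀-⊗ (b ∷ f) g)))))
      (suc k) → trans (coeff-suc-∷⊗ (a * b) (scale a f) g k)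
                  (trans (+-congˡ (trans (at (scale-⊗ a f g) k) (coeff-scale a (f ⊗ g) k)))
                  (trans (factor a b (coeff g (suc k)) (coeff (f ⊗ g) k))
                         (sym (trans (coeff-scale a ((b ∷ f) ⊗ g) (suc k)) (*-congˡ (coeff-suc-∷⊗ b f g k))))))
    where
    factor : ∀ a b x y → (a * b) * x + a * y ≈ a * (b * x + y)
    factor = solve 4 (λ a b x y → (a :* b) :* x :+ a :* y := a :* (b :* x :+ y)) refl

  0∷-⊗ : ∀ f g → ((0# ∷ f) ⊗ g) ≋ (0# ∷ (f ⊗ g))
  0∷-⊗ f g = mk≋ λ where
      zero    → trans (coeff₀-⊗ (0# ∷ f) g) (zeroˡ _)
      (suc k) → trans (coeff-suc-∷⊗ 0# f g k) (trans (+-congʳ (zeroˡ _)) (+-identityˡ _))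

  ⊗-assoc : ∀ f g h → ((f ⊗ g) ⊗ h) ≋ (f ⊗ (g ⊗ h))
  ⊗-assoc []      g h = ≋-refl
  ⊗-assoc (a ∷ f) g h = begin
    (scale a g ⊕ (0# ∷ (f ⊗ g))) ⊗ h         ≈⟨ ⊗-distribʳ-⊕ (scale a g) (0# ∷ (f ⊗ g)) h ⟩
    (scale a g ⊗ h) ⊕ ((0# ∷ (f ⊗ g)) ⊗ h)   ≈⟨ ⊕-cong (scale-⊗ a g h) (0∷-⊗ (f ⊗ g) h) ⟩
    scale a (g ⊗ h) ⊕ (0# ∷ ((f ⊗ g) ⊗ h))   ≈⟨ ⊕-cong ≋-refl (∷-cong refl (⊗-assoc f g h)) ⟩
    scale a (g ⊗ h) ⊕ (0# ∷ (f ⊗ (g ⊗ h)))   ∎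
    where open ≋-Reasoning

  const-⊗ : ∀ a g → (const a ⊗ g) ≋ scale a g
  const-⊗ a g = ⊕-identityʳ (scale a g) (IsZero-0∷ ≋-refl)

  -- The substitution x ↦ x + 1 and evaluation at 1

  X+1 : Pol
  X+1 = 1# ∷ 1# ∷ []

  coeff-1⊗ : ∀ g k → coeff ((1# ∷ []) ⊗ g) k ≈ coeff g k
  coeff-1⊗ g k = trans (at (const-⊗ 1# g) k) (trans (coeff-scale 1# g k) (*-identityˡ _))

  coeff₀-X+1⊗ : ∀ g → coeff (X+1 ⊗ g) 0 ≈ coeff g 0
  coeff₀-X+1⊗ g = trans (coeff₀-⊗ X+1 g) (*-identityˡ _)

  coeff-suc-X+1⊗ : ∀ g k → coeff (X+1 ⊗ g) (suc k) ≈ coeff g (suc k) + coeff g k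
  coeff-suc-X+1⊗ g k = trans (coeff-suc-∷⊗ 1# (1# ∷ []) g k) (+-cong (*-identityˡ _) (coeff-1⊗ g k))

  coeff₀-shift-∷ : ∀ a f → coeff (shift (a ∷ f)) 0 ≈ a + coeff (shift f) 0
  coeff₀-shift-∷ a f = trans (coeff-⊕ (const a) (X+1 ⊗ shift f) 0) (+-congˡ (coeff₀-X+1⊗ (shift f)))

  coeff-suc-shift-∷ : ∀ a f k →
    coeff (shift (a ∷ f)) (suc k) ≈ coeff (shift f) (suc k) + coeff (shift f) k
  coeff-suc-shift-∷ a f k = trans (coeff-⊕ (const a) (X+1 ⊗ shift f) (suc k))
    (trans (+-identityˡ _) (coeff-suc-X+1⊗ (shift f) k))

  shift-zero : ∀ f → IsZero f → IsZero (shift f)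
  shift-zero []      _   = ≋-refl
  shift-zero (a ∷ f) f≋0 = mk≋ λ where
      zero    → trans (coeff₀-shift-∷ a f) (trans (+-cong (at f≋0 0) (at ih 0)) (+-identityʳ _))
      (suc k) → trans (coeff-suc-shift-∷ a f k) (trans (+-cong (at ih (suc k)) (at ih k)) (+-identityʳ _))
    where
    ih = shift-zero f (IsZero-tail f≋0)

  shift-cong : ∀ {f g} → f ≋ g → shift f ≋ shift g
  shift-cong {[]}    {[]}    _   = ≋-refl
  shift-cong {[]}    {b ∷ g} f≋g = ≋-sym (shift-zero (b ∷ g) (≋-sym f≋g))
  shift-cong {a ∷ f} {[]}    f≋g = shift-zero (a ∷ f) f≋g
  shift-cong {a ∷ f} {b ∷ g} f≋g = mk≋ λ where
      zero    → trans (coeff₀-shift-∷ a f)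
                  (trans (+-cong (at f≋g 0) (at ih 0)) (sym (coeff₀-shift-∷ b g)))
      (suc k) → trans (coeff-suc-shift-∷ a f k)
                  (trans (+-cong (at ih (suc k)) (at ih k)) (sym (coeff-suc-shift-∷ b g k)))
    where
    ih = shift-cong (tail-cong f≋g)

  shift-⊕ : ∀ f g → shift (f ⊕ g) ≋ (shift f ⊕ shift g)
  shift-⊕ []      g       = ≋-refl
  shift-⊕ (a ∷ f) []      = ≋-sym (⊕-identityʳ _ ≋-refl)
  shift-⊕ (a ∷ f) (b ∷ g) = mk≋ λ where
      zero    → trans (coeff₀-shift-∷ (a + b) (f ⊕ g))
                  (trans (+-congˡ (ih 0)) (trans (+-interchange a b _ _)
                  (sym (trans (coeff-⊕ (shift (a ∷ f)) (shift (b ∷ g)) 0)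
                              (+-cong (coeff₀-shift-∷ a f) (coeff₀-shift-∷ b g))))))
      (suc k) → trans (coeff-suc-shift-∷ (a + b) (f ⊕ g) k)
                  (trans (+-cong (ih (suc k)) (ih k)) (trans (+-interchange _ _ _ _)
                  (sym (trans (coeff-⊕ (shift (a ∷ f)) (shift (b ∷ g)) (suc k))
                              (+-cong (coeff-suc-shift-∷ a f k) (coeff-suc-shift-∷ b g k))))))
    where
    ih : ∀ k → coeff (shift (f ⊕ g)) k ≈ coeff (shift f) k + coeff (shift g) k
    ih k = trans (at (shift-⊕ f g) k) (coeff-⊕ (shift f) (shift g) k)

  shift-scale : ∀ a f → shift (scale a f) ≋ scale a (shift f)
  shift-scale a []      = ≋-refl
  shift-scale a (b ∷ f) = mk≋ λ where
      zero    → trans (coeff₀-shift-∷ (a * b) (scale a f))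
                  (trans (+-congˡ (ih 0)) (trans (sym (distribˡ a b _))
                  (sym (trans (coeff-scale a (shift (b ∷ f)) 0) (*-congˡ (coeff₀-shift-∷ b f))))))
      (suc k) → trans (coeff-suc-shift-∷ (a * b) (scale a f) k)
                  (trans (+-cong (ih (suc k)) (ih k)) (trans (sym (distribˡ a _ _))
                  (sym (trans (coeff-scale a (shift (b ∷ f)) (suc k)) (*-congˡ (coeff-suc-shift-∷ b f k))))))
    where
    ih : ∀ k → coeff (shift (scale a f)) k ≈ a * coeff (shift f) k
    ih k = trans (at (shift-scale a f) k) (coeff-scale a (shift f) k)

  shift-const : ∀ a → shift (const a) ≋ const a
  shift-const a = mk≋ λ where
    zero    → trans (coeff₀-shift-∷ a []) (+-identityʳ _)
    (suc k) → trans (coeff-suc-shift-∷ a [] k) (+-identityʳ _)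

  shift-⊗ : ∀ f g → shift (f ⊗ g) ≋ (shift f ⊗ shift g)
  shift-⊗ []      g = ≋-refl
  shift-⊗ (a ∷ f) g = begin
    shift (scale a g ⊕ (0# ∷ (f ⊗ g)))
      ≈⟨ shift-⊕ (scale a g) (0# ∷ (f ⊗ g)) ⟩
    shift (scale a g) ⊕ (const 0# ⊕ (X+1 ⊗ shift (f ⊗ g)))
      ≈⟨ ⊕-cong (shift-scale a g) (⊕-identityˡ _ (IsZero-0∷ ≋-refl)) ⟩
    scale a (shift g) ⊕ (X+1 ⊗ shift (f ⊗ g))
      ≈⟨ ⊕-cong (const-⊗ a (shift g)) (⊗-congʳ X+1 (≋-sym (shift-⊗ f g))) ⟨
    (const a ⊗ shift g) ⊕ (X+1 ⊗ (shift f ⊗ shift g))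
      ≈⟨ ⊕-cong ≋-refl (⊗-assoc X+1 (shift f) (shift g)) ⟨
    (const a ⊗ shift g) ⊕ ((X+1 ⊗ shift f) ⊗ shift g)
      ≈⟨ ⊗-distribʳ-⊕ (const a) (X+1 ⊗ shift f) (shift g) ⟨
    shift (a ∷ f) ⊗ shift g
      ∎
    where open ≋-Reasoning

  shift-pow : ∀ f k → shift (pow f k) ≋ pow (shift f) k
  shift-pow f zero    = shift-const 1#
  shift-pow f (suc k) = ≋-trans (shift-⊗ f (pow f k)) (⊗-congʳ (shift f) (shift-pow f k))

  shift-X : shift X ≋ X+1
  shift-X = mk≋ λ where
    zero          → trans (coeff₀-shift-∷ 0# (1# ∷ []))
                      (trans (+-identityˡ _) (trans (coeff₀-shift-∷ 1# []) (+-identityʳ _)))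
    (suc zero)    → trans (coeff-suc-shift-∷ 0# (1# ∷ []) 0)
                      (trans (+-cong (trans (coeff-suc-shift-∷ 1# [] 0) (+-identityʳ _))
                                     (trans (coeff₀-shift-∷ 1# []) (+-identityʳ _)))
                             (+-identityˡ _))
    (suc (suc k)) → trans (coeff-suc-shift-∷ 0# (1# ∷ []) (suc k))
                      (trans (+-cong (trans (coeff-suc-shift-∷ 1# [] (suc k)) (+-identityʳ _))
                                     (trans (coeff-suc-shift-∷ 1# [] k) (+-identityʳ _)))
                             (+-identityʳ _))


  eval1-⊕ : ∀ f g → eval1 (f ⊕ g) ≈ eval1 f + eval1 g
  eval1-⊕ []      g       = sym (+-identityˡ _)
  eval1-⊕ (a ∷ f) []      = sym (+-identityʳ _)
  eval1-⊕ (a ∷ f) (b ∷ g) = trans (+-congˡ (eval1-⊕ f g)) (+-interchange a b _ _)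

  eval1-scale : ∀ a f → eval1 (scale a f) ≈ a * eval1 f
  eval1-scale a []      = sym (zeroʳ a)
  eval1-scale a (b ∷ f) = trans (+-congˡ (eval1-scale a f)) (sym (distribˡ a b _))

  eval1-⊗ : ∀ f g → eval1 (f ⊗ g) ≈ eval1 f * eval1 g
  eval1-⊗ []      g = sym (zeroˡ _)
  eval1-⊗ (a ∷ f) g = trans (eval1-⊕ (scale a g) (0# ∷ (f ⊗ g)))
    (trans (+-cong (eval1-scale a g) (trans (+-identityˡ _) (eval1-⊗ f g))) (sym (distribʳ _ a _)))

  eval1-X^ : ∀ k → eval1 (pow X k) ≈ 1#
  eval1-X^ zero    = +-identityʳ _
  eval1-X^ (suc k) = trans (eval1-⊗ X (pow X k))
    (trans (*-cong (trans (+-identityˡ _) (+-identityʳ _)) (eval1-X^ k)) (*-identityˡ _))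

  coeff₀-shift : ∀ f → coeff (shift f) 0 ≈ eval1 f
  coeff₀-shift []      = refl
  coeff₀-shift (a ∷ f) = trans (coeff₀-shift-∷ a f) (+-congˡ (coeff₀-shift f))

  record IsLinear (φ : Pol → Pol) : Set (c ⊔ ℓ) where
    field
      cong       : ∀ {f g} → f ≋ g → φ f ≋ φ g
      ⊕-homo     : ∀ f g → φ (f ⊕ g) ≋ (φ f ⊕ φ g)
      scale-homo : ∀ a f → φ (scale a f) ≋ scale a (φ f)

    zero-homo : ∀ {f} → IsZero f → IsZero (φ f)
    zero-homo f≋0 = ≋-trans (cong f≋0) (≋-trans (scale-homo 0# []) (scale-by-0 (φ [])))

  iter-isLinear : ∀ {φ} → IsLinear φ → ∀ t → IsLinear (iter t φ)
  iter-isLinear φ-lin zero    = record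
    { cong = λ f≋g → f≋g ; ⊕-homo = λ _ _ → ≋-refl ; scale-homo = λ _ _ → ≋-refl }
  iter-isLinear φ-lin (suc t) = record
    { cong       = λ f≋g → cong (IsLinear.cong ih f≋g)
    ; ⊕-homo     = λ f g → ≋-trans (cong (IsLinear.⊕-homo ih f g)) (⊕-homo _ _)
    ; scale-homo = λ a f → ≋-trans (cong (IsLinear.scale-homo ih a f)) (scale-homo a _)
    }
    where
    open IsLinear φ-lin
    ih = iter-isLinear φ-lin t


  Δ : Pol → Pol
  Δ f = shift f ⊖ f

  coeff₀-opAmI : ∀ f → coeff (opAmI f) 0 ≈ - coeff f 0
  coeff₀-opAmI f = begin
    coeff (opA f ⊖ f) 0                       ≈⟨ coeff-⊖ (opA f) f 0 ⟩
    coeff (opA f) 0 - coeff f 0               ≈⟨ +-congʳ (coeff-⊖ (shift f) (const (eval1 f)) 0) ⟩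
    (coeff (shift f) 0 - eval1 f) - coeff f 0 ≈⟨ +-congʳ (+-congʳ (coeff₀-shift f)) ⟩
    (eval1 f - eval1 f) - coeff f 0           ≈⟨ +-congʳ (-‿inverseʳ _) ⟩
    0# - coeff f 0                            ≈⟨ +-identityˡ _ ⟩
    - coeff f 0                               ∎
    where open ≈-Reasoning

  coeff-suc-opAmI : ∀ f k → coeff (opAmI f) (suc k) ≈ coeff (Δ f) (suc k)
  coeff-suc-opAmI f k = begin
    coeff (opA f ⊖ f) (suc k)                            ≈⟨ coeff-⊖ (opA f) f (suc k) ⟩
    coeff (opA f) (suc k) - coeff f (suc k)              ≈⟨ +-congʳ (coeff-⊖ (shift f) (const (eval1 f)) (suc k)) ⟩
    (coeff (shift f) (suc k) - 0#) - coeff f (suc k)     ≈⟨ +-congʳ (trans (+-congˡ -0#≈0#) (+-identityʳ _)) ⟩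
    coeff (shift f) (suc k) - coeff f (suc k)            ≈⟨ coeff-⊖ (shift f) f (suc k) ⟨
    coeff (Δ f) (suc k)                                  ∎
    where open ≈-Reasoning

  opAmI-isLinear : IsLinear opAmI
  opAmI-isLinear = record { cong = opAmI-cong ; ⊕-homo = opAmI-⊕ ; scale-homo = opAmI-scale }
    where
    coeff-suc-Δ : ∀ f k → coeff (opAmI f) (suc k) ≈ coeff (shift f) (suc k) - coeff f (suc k)
    coeff-suc-Δ f k = trans (coeff-suc-opAmI f k) (coeff-⊖ (shift f) f (suc k))

    opAmI-cong : ∀ {f g} → f ≋ g → opAmI f ≋ opAmI g
    opAmI-cong {f} {g} f≋g = mk≋ λ where
        zero    → trans (coeff₀-opAmI f) (trans (-‿cong (at f≋g 0)) (sym (coeff₀-opAmI g)))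
        (suc k) → trans (coeff-suc-Δ f k)
                    (trans (+-cong (at (shift-cong f≋g) (suc k)) (-‿cong (at f≋g (suc k))))
                           (sym (coeff-suc-Δ g k)))

    opAmI-⊕ : ∀ f g → opAmI (f ⊕ g) ≋ (opAmI f ⊕ opAmI g)
    opAmI-⊕ f g = mk≋ λ where
        zero    → trans (coeff₀-opAmI (f ⊕ g))
                    (trans (-‿cong (coeff-⊕ f g 0)) (trans (sym (⁻¹-∙-comm _ _))
                    (sym (trans (coeff-⊕ (opAmI f) (opAmI g) 0) (+-cong (coeff₀-opAmI f) (coeff₀-opAmI g))))))
        (suc k) → trans (coeff-suc-Δ (f ⊕ g) k)
                    (trans (+-cong (trans (at (shift-⊕ f g) (suc k)) (coeff-⊕ (shift f) (shift g) (suc k)))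
                                   (trans (-‿cong (coeff-⊕ f g (suc k))) (sym (⁻¹-∙-comm _ _))))
                    (trans (+-interchange _ _ _ _)
                    (sym (trans (coeff-⊕ (opAmI f) (opAmI g) (suc k)) (+-cong (coeff-suc-Δ f k) (coeff-suc-Δ g k))))))

    opAmI-scale : ∀ a f → opAmI (scale a f) ≋ scale a (opAmI f)
    opAmI-scale a f = mk≋ λ where
        zero    → trans (coeff₀-opAmI (scale a f))
                    (trans (-‿cong (coeff-scale a f 0)) (trans (-‿distribʳ-* a _)
                    (sym (trans (coeff-scale a (opAmI f) 0) (*-congˡ (coeff₀-opAmI f))))))
        (suc k) → trans (coeff-suc-Δ (scale a f) k)
                    (trans (+-cong (trans (at (shift-scale a f) (suc k)) (coeff-scale a (shift f) (suc k)))
                                   (trans (-‿cong (coeff-scale a f (suc k))) (-‿distribʳ-* a _)))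
                    (trans (sym (distribˡ a _ _))
                    (sym (trans (coeff-scale a (opAmI f) (suc k)) (*-congˡ (coeff-suc-Δ f k))))))

  -- Degrees and top coefficients

  record Deg< (f : Pol) (d : ℕ) : Set ℓ where
    constructor deg<
    field vanish : ∀ k → d ≤ k → coeff f k ≈ 0#
  open Deg< public

  record Leading (f : Pol) (e : ℕ) (a : Carrier) : Set ℓ where
    constructor leading
    field
      below : Deg< f (suc e)
      top   : coeff f e ≈ a
  open Leading public

  Deg<-mono : ∀ {f d d′} → d ≤ d′ → Deg< f d → Deg< f d′
  Deg<-mono d≤d′ f<d = deg< λ k d′≤k → vanish f<d k (ℕ.≤-trans d≤d′ d′≤k)

  Deg<-cong : ∀ {f g d} → f ≋ g → Deg< f d → Deg< g d
  Deg<-cong f≋g f<d = deg< λ k d≤k → trans (sym (at f≋g k)) (vanish f<d k d≤k)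

  Deg<-tail : ∀ {a f d} → Deg< (a ∷ f) (suc d) → Deg< f d
  Deg<-tail f<d = deg< λ k d≤k → vanish f<d (suc k) (s≤s d≤k)

  Deg<0⇒IsZero : ∀ {f} → Deg< f 0 → IsZero f
  Deg<0⇒IsZero f<0 = mk≋ λ k → vanish f<0 k z≤n

  Deg<1⇒IsZero : ∀ {f} → coeff f 0 ≈ 0# → Deg< f 1 → IsZero f
  Deg<1⇒IsZero f₀≈0 f<1 = mk≋ λ where
    zero    → f₀≈0
    (suc k) → vanish f<1 (suc k) (s≤s z≤n)

  Deg<-lower : ∀ {f d} → Deg< f (suc d) → coeff f d ≈ 0# → Deg< f d
  Deg<-lower {f} {d} f<d+1 f_d≈0 = deg< vanish′
    where
    vanish′ : ∀ k → d ≤ k → coeff f k ≈ 0#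
    vanish′ k d≤k with ℕ.m≤n⇒m<n∨m≡n d≤k
    ... | inj₁ d<k    = vanish f<d+1 k d<k
    ... | inj₂ ≡.refl = f_d≈0


  δ : ℕ → ℕ → Carrier
  δ zero    zero    = 1#
  δ zero    (suc i) = 0#
  δ (suc k) zero    = 0#
  δ (suc k) (suc i) = δ k i

  δ-diag : ∀ k → δ k k ≈ 1#
  δ-diag zero    = refl
  δ-diag (suc k) = δ-diag k

  δ-≢ : ∀ k i → ¬ k ≡.≡ i → δ k i ≈ 0#
  δ-≢ zero    zero    k≢i = contradiction ≡.refl k≢i
  δ-≢ zero    (suc i) _   = refl
  δ-≢ (suc k) zero    _   = refl
  δ-≢ (suc k) (suc i) k≢i = δ-≢ k i (λ k≡i → k≢i (≡.cong suc k≡i))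

  coeff-X⊗ : ∀ g k → coeff (X ⊗ g) (suc k) ≈ coeff g k
  coeff-X⊗ g k = trans (coeff-suc-∷⊗ 0# (1# ∷ []) g k)
    (trans (+-congʳ (zeroˡ _)) (trans (+-identityˡ _) (coeff-1⊗ g k)))

  coeff-X^ : ∀ k i → coeff (pow X k) i ≈ δ k i
  coeff-X^ zero    zero    = refl
  coeff-X^ zero    (suc i) = refl
  coeff-X^ (suc k) zero    = trans (coeff₀-⊗ X (pow X k)) (zeroˡ _)
  coeff-X^ (suc k) (suc i) = trans (coeff-X⊗ (pow X k) i) (coeff-X^ k i)

  Leading-X^ : ∀ k → Leading (pow X k) k 1#
  Leading-X^ k = leading
    (deg< λ i k<i → trans (coeff-X^ k i) (δ-≢ k i (ℕ.<⇒≢ k<i)))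
    (trans (coeff-X^ k k) (δ-diag k))

  Leading-cong : ∀ {f e a a′} → a ≈ a′ → Leading f e a → Leading f e a′
  Leading-cong a≈a′ f-lead = leading (below f-lead) (trans (top f-lead) a≈a′)

  ⊗-leading : ∀ f g a b → Deg< f (suc a) → Deg< g (suc b) →
              Leading (f ⊗ g) (a ℕ.+ b) (coeff f a * coeff g b)
  ⊗-leading []      g a       b _   _   = leading (deg< λ _ _ → refl) (sym (zeroˡ _))
  ⊗-leading (c ∷ f) g zero    b f<1 g<b = leading
    (deg< λ where
      (suc k) (s≤s b≤k) → trans (coeff-suc-∷⊗ c f g k)
        (trans (+-cong (c*g≈0 (s≤s b≤k)) (at f⊗g≈0 k)) (+-identityʳ _)))
    (trans (coeff-∷⊗ c f g b) (trans (+-congˡ (at (IsZero-0∷ f⊗g≈0) b)) (+-identityʳ _)))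
    where
    f⊗g≈0 = ⊗-zeroˡ f g (Deg<0⇒IsZero (Deg<-tail f<1))
    c*g≈0 : ∀ {k} → suc b ≤ k → c * coeff g k ≈ 0#
    c*g≈0 b<k = trans (*-congˡ (vanish g<b _ b<k)) (zeroʳ c)
  ⊗-leading (c ∷ f) g (suc a) b f<a g<b = leading
    (deg< λ where
      (suc k) (s≤s a+b<k) → trans (coeff-suc-∷⊗ c f g k)
        (trans (+-cong (c*g≈0 (ℕ.≤-trans (s≤s (ℕ.m≤n+m b a)) (ℕ.m≤n⇒m≤1+n a+b<k)))
                       (vanish (below ih) k a+b<k))
               (+-identityʳ _)))
    (trans (coeff-suc-∷⊗ c f g (a ℕ.+ b))
      (trans (+-cong (c*g≈0 (s≤s (ℕ.m≤n+m b a))) (top ih)) (+-identityˡ _)))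
    where
    ih = ⊗-leading f g a b (Deg<-tail f<a) g<b
    c*g≈0 : ∀ {k} → suc b ≤ k → c * coeff g k ≈ 0#
    c*g≈0 b<k = trans (*-congˡ (vanish g<b _ b<k)) (zeroʳ c)

  Leading-⊗ : ∀ {f g a b u v} → Leading f a u → Leading g b v → Leading (f ⊗ g) (a ℕ.+ b) (u * v)
  Leading-⊗ {f} {g} {a} {b} f-lead g-lead =
    Leading-cong (*-cong (top f-lead) (top g-lead)) (⊗-leading f g a b (below f-lead) (below g-lead))


  shift-leading : ∀ f d → Deg< f (suc d) → Leading (shift f) d (coeff f d)
  shift-leading []      d       _   = leading (deg< λ _ _ → refl) refl
  shift-leading (a ∷ f) zero    f<1 = leading
    (deg< λ where
      (suc k) _ → trans (coeff-suc-shift-∷ a f k) (trans (+-cong (at sf≈0 (suc k)) (at sf≈0 k)) (+-identityʳ _)))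
    (trans (coeff₀-shift-∷ a f) (trans (+-congˡ (at sf≈0 0)) (+-identityʳ a)))
    where
    sf≈0 = shift-zero f (Deg<0⇒IsZero (Deg<-tail f<1))
  shift-leading (a ∷ f) (suc d) f<d = leading
    (deg< λ where
      (suc k) (s≤s d<k) → trans (coeff-suc-shift-∷ a f k)
        (trans (+-cong (vanish (below ih) (suc k) (ℕ.m≤n⇒m≤1+n d<k)) (vanish (below ih) k d<k))
               (+-identityʳ _)))
    (trans (coeff-suc-shift-∷ a f d)
      (trans (+-cong (vanish (below ih) (suc d) ℕ.≤-refl) (top ih)) (+-identityˡ _)))
    where
    ih = shift-leading f d (Deg<-tail f<d)

  -- The binomial expansion of f(x + 1) puts (e + 1) b just below the top coefficient b.
  coeff-shift-subleading : ∀ f e {b} → Leading f (suc e) b →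
                           coeff (shift f) e ≈ coeff f e + (suc e × 1#) * b
  coeff-shift-subleading []      e       f-lead =
    sym (trans (+-identityˡ _) (trans (*-congˡ (sym (top f-lead))) (zeroʳ _)))
  coeff-shift-subleading (a ∷ f) zero    f-lead =
    trans (coeff₀-shift-∷ a f) (+-congˡ (trans (top (shift-leading f 0 (Deg<-tail (below f-lead))))
      (trans (top f-lead) (sym (trans (*-congʳ (+-identityʳ 1#)) (*-identityˡ _))))))
  coeff-shift-subleading (a ∷ f) (suc e) {b} f-lead = begin
    coeff (shift (a ∷ f)) (suc e)               ≈⟨ coeff-suc-shift-∷ a f e ⟩
    coeff (shift f) (suc e) + coeff (shift f) e ≈⟨ +-cong (trans (top (shift-leading f (suc e) f<)) (top f-lead))
                                                          (coeff-shift-subleading f e (leading f< (top f-lead))) ⟩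
    b + (coeff f e + (suc e × 1#) * b)          ≈⟨ collect b (coeff f e) (suc e × 1#) ⟩
    coeff f e + (1# + suc e × 1#) * b           ∎
    where
    open ≈-Reasoning
    f< = Deg<-tail (below f-lead)
    collect : ∀ b x n → b + (x + n * b) ≈ x + (1# + n) * b
    collect = solve 3 (λ b x n → b :+ (x :+ n :* b) := x :+ (con 1 :+ n) :* b) refl

  Δ-Deg< : ∀ f d → Deg< f (suc d) → Deg< (Δ f) d
  Δ-Deg< f d f<d+1 = deg< λ k d≤k → trans (coeff-⊖ (shift f) f k) (top-cancels k d≤k)
    where
    sf = shift-leading f d f<d+1
    top-cancels : ∀ k → d ≤ k → coeff (shift f) k - coeff f k ≈ 0#
    top-cancels k d≤k with ℕ.m≤n⇒m<n∨m≡n d≤k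
    ... | inj₁ d<k    = trans (+-cong (vanish (below sf) k d<k) (-‿cong (vanish f<d+1 k d<k))) (-‿inverseʳ 0#)
    ... | inj₂ ≡.refl = trans (+-congʳ (top sf)) (-‿inverseʳ _)

  Δ^-Deg< : ∀ t d f → Deg< f (t ℕ.+ d) → Deg< (iter t Δ f) d
  Δ^-Deg< zero    d f f<d = f<d
  Δ^-Deg< (suc t) d f f<  = Δ-Deg< (iter t Δ f) d
    (Δ^-Deg< t (suc d) f (Deg<-mono (ℕ.≤-reflexive (≡.sym (ℕ.+-suc t d))) f<))

  opAmI-coeff₀ : ∀ f → coeff f 0 ≈ 0# → coeff (opAmI f) 0 ≈ 0#
  opAmI-coeff₀ f f₀≈0 = trans (coeff₀-opAmI f) (trans (-‿cong f₀≈0) -0#≈0#)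

  opAmI-Deg< : ∀ {f} d → coeff f 0 ≈ 0# → Deg< f (suc d) → Deg< (opAmI f) d
  opAmI-Deg< {f} d f₀≈0 f<d+1 = deg< λ where
      zero    _   → opAmI-coeff₀ f f₀≈0
      (suc k) d≤k → trans (coeff-suc-opAmI f k) (vanish (Δ-Deg< f d f<d+1) (suc k) d≤k)

  opAmI^-coeff₀ : ∀ t f → coeff f 0 ≈ 0# → coeff (iter t opAmI f) 0 ≈ 0#
  opAmI^-coeff₀ zero    f f₀≈0 = f₀≈0
  opAmI^-coeff₀ (suc t) f f₀≈0 = opAmI-coeff₀ (iter t opAmI f) (opAmI^-coeff₀ t f f₀≈0)

  opAmI^-Deg< : ∀ t d f → coeff f 0 ≈ 0# → Deg< f (t ℕ.+ d) → Deg< (iter t opAmI f) d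
  opAmI^-Deg< zero    d f f₀≈0 f< = f<
  opAmI^-Deg< (suc t) d f f₀≈0 f< = opAmI-Deg< d (opAmI^-coeff₀ t f f₀≈0)
    (opAmI^-Deg< t (suc d) f f₀≈0 (Deg<-mono (ℕ.≤-reflexive (≡.sym (ℕ.+-suc t d))) f<))

  opAmI-leading : ∀ f s {b} → Leading f (2 ℕ.+ s) b → Leading (opAmI f) (suc s) (((2 ℕ.+ s) × 1#) * b)
  opAmI-leading f s {b} f-lead = leading
    (deg< λ where
      (suc k) s<k → trans (coeff-suc-opAmI f k) (vanish (Δ-Deg< f (2 ℕ.+ s) (below f-lead)) (suc k) s<k))
    (trans (coeff-suc-opAmI f s) (begin
      coeff (shift f ⊖ f) (suc s)               ≈⟨ coeff-⊖ (shift f) f (suc s) ⟩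
      coeff (shift f) (suc s) - coeff f (suc s) ≈⟨ +-congʳ (coeff-shift-subleading f (suc s) f-lead) ⟩
      (coeff f (suc s) + c·b) - coeff f (suc s) ≈⟨ +-congʳ (+-comm _ _) ⟩
      (c·b + coeff f (suc s)) - coeff f (suc s) ≈⟨ +-assoc _ _ _ ⟩
      c·b + (coeff f (suc s) - coeff f (suc s)) ≈⟨ +-congˡ (-‿inverseʳ _) ⟩
      c·b + 0#                                  ≈⟨ +-identityʳ _ ⟩
      c·b                                       ∎))
    where
    open ≈-Reasoning
    c·b = ((2 ℕ.+ s) × 1#) * b

  opAmI^-leading : ∀ t s f {b} → Leading f (t ℕ.+ suc s) b →
                   Leading (iter t opAmI f) (suc s) ((rising (2 ℕ.+ s) t × 1#) * b)
  opAmI^-leading zero    s f f-lead = Leading-cong (sym (trans (*-congʳ (+-identityʳ 1#)) (*-identityˡ _))) f-lead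
  opAmI^-leading (suc t) s f {b} f-lead = Leading-cong combine
    (opAmI-leading (iter t opAmI f) s
      (opAmI^-leading t (suc s) f (≡.subst (λ e → Leading f e b) (≡.sym (ℕ.+-suc t (suc s))) f-lead)))
    where
    combine : ((2 ℕ.+ s) × 1#) * ((rising (3 ℕ.+ s) t × 1#) * b) ≈ (rising (2 ℕ.+ s) (suc t) × 1#) * b
    combine = trans (sym (*-assoc _ _ _)) (*-congʳ (sym (×1-homo-* (2 ℕ.+ s) (rising (3 ℕ.+ s) t))))


  opAmI-⊗-invariant : ∀ h u → shift u ≋ u → eval1 u ≈ 0# → opAmI (h ⊗ u) ≋ (Δ h ⊗ u)
  opAmI-⊗-invariant h u su≋u u1≈0 = begin
    (shift (h ⊗ u) ⊖ const (eval1 (h ⊗ u))) ⊖ (h ⊗ u)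
      ≈⟨ ⊖-cong (⊕-identityʳ (shift (h ⊗ u)) (scale-zero (- 1#) c≈0)) ≋-refl ⟩
    shift (h ⊗ u) ⊖ (h ⊗ u)
      ≈⟨ ⊖-cong (≋-trans (shift-⊗ h u) (⊗-congʳ (shift h) su≋u)) ≋-refl ⟩
    (shift h ⊗ u) ⊖ (h ⊗ u)
      ≈⟨ ⊕-cong ≋-refl (scale-⊗ (- 1#) h u) ⟨
    (shift h ⊗ u) ⊕ (neg h ⊗ u)
      ≈⟨ ⊗-distribʳ-⊕ (shift h) (neg h) u ⟨
    Δ h ⊗ u
      ∎
    where
    open ≋-Reasoning
    c≈0 : IsZero (const (eval1 (h ⊗ u)))
    c≈0 = IsZero-const (trans (eval1-⊗ h u) (trans (*-congˡ u1≈0) (zeroʳ _)))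

  opAmI^-⊗-invariant : ∀ t h u → shift u ≋ u → eval1 u ≈ 0# →
                       iter t opAmI (h ⊗ u) ≋ (iter t Δ h ⊗ u)
  opAmI^-⊗-invariant zero    h u _     _    = ≋-refl
  opAmI^-⊗-invariant (suc t) h u su≋u u1≈0 =
    ≋-trans (IsLinear.cong opAmI-isLinear (opAmI^-⊗-invariant t h u su≋u u1≈0))
            (opAmI-⊗-invariant (iter t Δ h) u su≋u u1≈0)

  -- Binomial coefficients and the polynomial x^p - x

  coeff-X+1^ : ∀ k i → coeff (pow X+1 k) i ≈ (k C i) × 1#
  coeff-X+1^ zero    zero    = sym (+-identityʳ 1#)
  coeff-X+1^ zero    (suc i) = refl
  coeff-X+1^ (suc k) zero    = trans (coeff₀-X+1⊗ (pow X+1 k)) (coeff-X+1^ k 0)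
  coeff-X+1^ (suc k) (suc i) = begin
    coeff (X+1 ⊗ pow X+1 k) (suc i)                    ≈⟨ coeff-suc-X+1⊗ (pow X+1 k) i ⟩
    coeff (pow X+1 k) (suc i) + coeff (pow X+1 k) i    ≈⟨ +-cong (coeff-X+1^ k (suc i)) (coeff-X+1^ k i) ⟩
    (k C suc i) × 1# + (k C i) × 1#                    ≈⟨ +-comm _ _ ⟩
    (k C i) × 1# + (k C suc i) × 1#                    ≈⟨ ×-homo-+ 1# (k C i) (k C suc i) ⟨
    (k C i ℕ.+ k C suc i) × 1#                         ≡⟨ ≡.cong (_× 1#) (nCk+nC[k+1]≡[n+1]C[k+1] k i) ⟩
    (suc k C suc i) × 1#                               ∎
    where open ≈-Reasoning

  coeff-X+1 : ∀ i → coeff X+1 i ≈ δ 0 i + coeff X i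
  coeff-X+1 zero          = sym (+-identityʳ 1#)
  coeff-X+1 (suc zero)    = sym (+-identityˡ 1#)
  coeff-X+1 (suc (suc i)) = sym (+-identityʳ 0#)

  eval1-X^-X : ∀ p → eval1 (pow X p ⊖ X) ≈ 0#
  eval1-X^-X p = begin
    eval1 (pow X p ⊖ X)                 ≈⟨ eval1-⊕ (pow X p) (neg X) ⟩
    eval1 (pow X p) + eval1 (neg X)     ≈⟨ +-cong (eval1-X^ p) (eval1-scale (- 1#) X) ⟩
    1# + - 1# * eval1 X                 ≈⟨ +-congˡ (*-congˡ (trans (+-identityˡ _) (+-identityʳ _))) ⟩
    1# + - 1# * 1#                      ≈⟨ +-congˡ (*-identityʳ _) ⟩
    1# - 1#                             ≈⟨ -‿inverseʳ 1# ⟩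
    0#                                  ∎
    where open ≈-Reasoning

  Leading-X^-X : ∀ p → 2 ≤ p → Leading (pow X p ⊖ X) p 1#
  Leading-X^-X (suc zero)      (s≤s ())
  Leading-X^-X p@(suc (suc _)) _ = leading
    (deg< λ where
      (suc zero) (s≤s ())
      (suc (suc i)) p<i → trans (coeff-⊖ (pow X p) X (suc (suc i)))
        (trans (+-cong (vanish (below (Leading-X^ p)) (suc (suc i)) p<i) (-‿cong refl)) (-‿inverseʳ 0#)))
    (trans (coeff-⊖ (pow X p) X p)
      (trans (+-cong (top (Leading-X^ p)) -0#≈0#) (+-identityʳ 1#)))

  coeff₀-X^-X : ∀ p → 1 ≤ p → coeff (pow X p ⊖ X) 0 ≈ 0#
  coeff₀-X^-X p@(suc _) _ = trans (coeff-⊖ (pow X p) X 0)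
    (trans (+-cong (coeff-X^ p 0) -0#≈0#) (+-identityʳ 0#))

  Leading-pow : ∀ {f e} s → Leading f e 1# → Leading (pow f s) (e ℕ.* s) 1#
  Leading-pow {f} {e} zero    _      = ≡.subst (λ d → Leading (const 1#) d 1#) (≡.sym (ℕ.*-zeroʳ e)) (Leading-X^ 0)
  Leading-pow {f} {e} (suc s) f-lead = ≡.subst (λ d → Leading (f ⊗ pow f s) d 1#) (≡.sym (ℕ.*-suc e s))
    (Leading-cong (*-identityˡ 1#) (Leading-⊗ f-lead (Leading-pow s f-lead)))

  X^-in-kernel : ∀ t k → k < t → IsZero (iter t opAmI (pow X (suc k)))
  X^-in-kernel t k k<t = Deg<1⇒IsZero (opAmI^-coeff₀ t (pow X (suc k)) (coeff-X^ (suc k) 0))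
    (opAmI^-Deg< t 1 (pow X (suc k)) (coeff-X^ (suc k) 0)
      (Deg<-mono (ℕ.≤-trans (s≤s k<t) (ℕ.≤-reflexive (ℕ.+-comm 1 t))) (below (Leading-X^ (suc k)))))

  linComb-zero : ∀ gs → IsZero (linComb gs (λ _ → 0#))
  linComb-zero []       = ≋-refl
  linComb-zero (g ∷ gs) = ≋-trans (⊕-identityʳ (scale 0# g) (linComb-zero gs)) (scale-by-0 g)

  linComb-⊕ : ∀ gs c c′ → linComb gs (λ i → c i + c′ i) ≋ (linComb gs c ⊕ linComb gs c′)
  linComb-⊕ []       c c′ = ≋-refl
  linComb-⊕ (g ∷ gs) c c′ = begin
    scale (c₀ + c′₀) g ⊕ linComb gs (λ i → tl c i + tl c′ i)
      ≈⟨ ⊕-cong (scale-distribʳ-+ c₀ c′₀ g) (linComb-⊕ gs (tl c) (tl c′)) ⟩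
    (scale c₀ g ⊕ scale c′₀ g) ⊕ (linComb gs (tl c) ⊕ linComb gs (tl c′))
      ≈⟨ ⊕-interchange (scale c₀ g) (scale c′₀ g) (linComb gs (tl c)) (linComb gs (tl c′)) ⟩
    (scale c₀ g ⊕ linComb gs (tl c)) ⊕ (scale c′₀ g ⊕ linComb gs (tl c′))
      ∎
    where
    open ≋-Reasoning
    c₀ = c Fin.zero
    c′₀ = c′ Fin.zero
    tl : (Fin (suc (length gs)) → Carrier) → Fin (length gs) → Carrier
    tl d i = d (Fin.suc i)

  linComb-scale : ∀ gs a c → linComb gs (λ i → a * c i) ≋ scale a (linComb gs c)
  linComb-scale []       a c = ≋-refl
  linComb-scale (g ∷ gs) a c = begin
    scale (a * c Fin.zero) g ⊕ linComb gs (λ i → a * c (Fin.suc i))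
      ≈⟨ ⊕-cong (scale-assoc a (c Fin.zero) g) (linComb-scale gs a (λ i → c (Fin.suc i))) ⟩
    scale a (scale (c Fin.zero) g) ⊕ scale a (linComb gs (λ i → c (Fin.suc i)))
      ≈⟨ scale-distrib-⊕ a (scale (c Fin.zero) g) (linComb gs (λ i → c (Fin.suc i))) ⟨
    scale a (linComb (g ∷ gs) c)
      ∎
    where open ≋-Reasoning

  record IsSubspace {ℓ′} (P : Pol → Set ℓ′) : Set (c ⊔ ℓ ⊔ ℓ′) where
    field
      zero-closed  : P []
      ⊕-closed     : ∀ {f g} → P f → P g → P (f ⊕ g)
      scale-closed : ∀ a {f} → P f → P (scale a f)
      cong         : ∀ {f g} → f ≋ g → P f → P g

    ⊖-scale-closed : ∀ a {f g} → P f → P g → P (f ⊖ scale a g)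
    ⊖-scale-closed a Pf Pg = ⊕-closed Pf (scale-closed (- 1#) (scale-closed a Pg))

  linComb-closed : ∀ {ℓ′} {P : Pol → Set ℓ′} → IsSubspace P →
                   ∀ gs → (∀ {g} → g ∈ gs → P g) → ∀ c → P (linComb gs c)
  linComb-closed P-sub []       _    _ = IsSubspace.zero-closed P-sub
  linComb-closed P-sub (g ∷ gs) P-gs c = ⊕-closed (scale-closed (c Fin.zero) (P-gs (here ≡.refl)))
    (linComb-closed P-sub gs (λ g∈gs → P-gs (there g∈gs)) (λ i → c (Fin.suc i)))
    where open IsSubspace P-sub

  InSpan-isSubspace : ∀ gs → IsSubspace (InSpan gs)
  InSpan-isSubspace gs = record
    { zero-closed  = (λ _ → 0#) , at (≋-sym (linComb-zero gs))
    ; ⊕-closed     = λ {f} {g} → ⊕-closed {f} {g}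
    ; scale-closed = λ a {f} → scale-closed a {f}
    ; cong         = λ {f} {g} → cong {f} {g}
    }
    where
    ⊕-closed : ∀ {f g} → InSpan gs f → InSpan gs g → InSpan gs (f ⊕ g)
    ⊕-closed {f} {g} (c , f≃) (c′ , g≃) = (λ i → c i + c′ i) ,
      at (≋-trans (⊕-cong (mk≋ {f} {linComb gs c} f≃) (mk≋ {g} {linComb gs c′} g≃))
                  (≋-sym (linComb-⊕ gs c c′)))
    scale-closed : ∀ a {f} → InSpan gs f → InSpan gs (scale a f)
    scale-closed a {f} (c , f≃) = (λ i → a * c i) ,
      at (≋-trans (scale-cong refl (mk≋ {f} {linComb gs c} f≃)) (≋-sym (linComb-scale gs a c)))
    cong : ∀ {f g} → f ≋ g → InSpan gs f → InSpan gs g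
    cong {f} f≋g (c , f≃) = c , at (≋-trans (≋-sym f≋g) (mk≋ {f} {linComb gs c} f≃))

  InSpan-∈ : ∀ {gs g} → g ∈ gs → InSpan gs g
  InSpan-∈ {g ∷ gs} (here ≡.refl) = (λ { Fin.zero → 1# ; (Fin.suc i) → 0# }) , at (≋-sym (begin
    scale 1# g ⊕ linComb gs (λ _ → 0#)   ≈⟨ ⊕-identityʳ (scale 1# g) (linComb-zero gs) ⟩
    scale 1# g                           ≈⟨ mk≋ (λ k → trans (coeff-scale 1# g k) (*-identityˡ _)) ⟩
    g                                    ∎))
    where open ≋-Reasoning
  InSpan-∈ {h ∷ gs} {g} (there g∈gs) with InSpan-∈ g∈gs
  ... | c , g≃ = (λ { Fin.zero → 0# ; (Fin.suc i) → c i }) ,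
    at (≋-trans (mk≋ {g} {linComb gs c} g≃)
                (≋-sym (⊕-identityˡ (linComb gs c) (scale-by-0 h))))

  module CharacteristicP {p} (prime : Prime p) (p×1≈0 : p × 1# ≈ 0#) where

    ×1-∣ : ∀ {k} → p ∣ k → k × 1# ≈ 0#
    ×1-∣ (divides q ≡.refl) = trans (×1-homo-* q p) (trans (*-congˡ p×1≈0) (zeroʳ _))

    -- Freshman's dream: (x + 1)^p = x^p + 1.
    coeff-X+1^p : ∀ i → coeff (pow X+1 p) i ≈ δ p i + δ 0 i
    coeff-X+1^p i = trans (coeff-X+1^ p i) (binomial-mod-p i)
      where
      p≢0 : ¬ p ≡.≡ 0
      p≢0 p≡0 = ¬prime[0] (≡.subst Prime p≡0 prime)
      binomial-mod-p : ∀ i → (p C i) × 1# ≈ δ p i + δ 0 i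
      binomial-mod-p zero = trans (+-comm 1# 0#) (+-congʳ (sym (δ-≢ p 0 p≢0)))
      binomial-mod-p (suc i) with ℕ.<-cmp (suc i) p
      ... | tri< i<p _ _    = trans (×1-∣ (p∣pCk prime (s≤s z≤n) i<p))
                                (sym (trans (+-identityʳ _) (δ-≢ p (suc i) (ℕ.>⇒≢ i<p))))
      ... | tri≈ _ ≡.refl _ = trans (≡.subst (λ n → n × 1# ≈ 1# + 0#) (≡.sym (nCn≡1 p)) refl)
                                (+-congʳ (sym (δ-diag p)))
      ... | tri> _ _ p<i    = trans (≡.subst (λ n → n × 1# ≈ 0#) (≡.sym (k>n⇒nCk≡0 p<i)) refl)
                                (sym (trans (+-identityʳ _) (δ-≢ p (suc i) (ℕ.<⇒≢ p<i))))

    shift-X^-X : shift (pow X p ⊖ X) ≋ (pow X p ⊖ X)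
    shift-X^-X = mk≋ λ i → begin
      coeff (shift (pow X p ⊖ X)) i                         ≈⟨ at (shift-⊕ (pow X p) (neg X)) i ⟩
      coeff (shift (pow X p) ⊕ shift (neg X)) i             ≈⟨ coeff-⊕ (shift (pow X p)) (shift (neg X)) i ⟩
      coeff (shift (pow X p)) i + coeff (shift (neg X)) i   ≈⟨ +-cong (at (≋-trans (shift-pow X p) (pow-cong p shift-X)) i)
                                                                      (at (≋-trans (shift-scale (- 1#) X)
                                                                                   (scale-cong refl shift-X)) i) ⟩
      coeff (pow X+1 p) i + coeff (neg X+1) i              ≈⟨ +-cong (coeff-X+1^p i) (coeff-neg-X+1 i) ⟩
      (δ p i + δ 0 i) + - (δ 0 i + coeff X i)              ≈⟨ cancel (δ p i) (δ 0 i) (coeff X i) ⟩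
      δ p i - coeff X i                                     ≈⟨ +-congʳ (coeff-X^ p i) ⟨
      coeff (pow X p) i - coeff X i                         ≈⟨ coeff-⊖ (pow X p) X i ⟨
      coeff (pow X p ⊖ X) i                                 ∎
      where
      open ≈-Reasoning
      coeff-neg-X+1 : ∀ i → coeff (neg X+1) i ≈ - (δ 0 i + coeff X i)
      coeff-neg-X+1 i = trans (coeff-scale (- 1#) X+1 i) (trans (-1*x≈-x _) (-‿cong (coeff-X+1 i)))
      cancel : ∀ a b x → (a + b) + - (b + x) ≈ a - x
      cancel a b x = begin
        (a + b) + - (b + x)         ≈⟨ +-congˡ (⁻¹-∙-comm b x) ⟨
        (a + b) + (- b + - x)       ≈⟨ regroup a b (- b) (- x) ⟩
        a + ((b - b) + - x)         ≈⟨ +-congˡ (trans (+-congʳ (-‿inverseʳ b)) (+-identityˡ _)) ⟩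
        a - x                       ∎
        where
        regroup : ∀ a b u v → (a + b) + (u + v) ≈ a + ((b + u) + v)
        regroup = solve 4 (λ a b u v → (a :+ b) :+ (u :+ v) := a :+ ((b :+ u) :+ v)) refl

    X^⊗T^-in-kernel : ∀ t r s → r < t → IsZero (iter t opAmI (pow X r ⊗ pow (pow X p ⊖ X) (suc s)))
    X^⊗T^-in-kernel t r s r<t = ≋-trans
      (opAmI^-⊗-invariant t (pow X r) (pow T (suc s))
        (≋-trans (shift-pow T (suc s)) (pow-cong (suc s) shift-X^-X))
        (trans (eval1-⊗ T (pow T s)) (trans (*-congʳ (eval1-X^-X p)) (zeroˡ _))))
      (⊗-zeroˡ _ (pow T (suc s)) (Deg<0⇒IsZero (Δ^-Deg< t 0 (pow X r)
        (Deg<-mono (ℕ.≤-trans r<t (ℕ.≤-reflexive (≡.sym (ℕ.+-identityʳ t)))) (below (Leading-X^ r))))))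
      where
      T = pow X p ⊖ X

module FiniteField {c ℓ} (F : Field c ℓ) where

  open import Data.Nat as ℕ using (ℕ; zero; suc)
  open import Data.Nat.Divisibility using (_∣_; m%n≡0⇒n∣m)
  open import Data.Nat.DivMod using (_%_; _/_; m≡m%n+[m/n]*n; m%n<n)
  open import Data.Nat.Primality using (Prime; prime⇒nonZero)
  open import Data.Nat.Coprimality using (prime⇒coprime; coprime-Bézout)
  open import Data.Nat.GCD using (module Bézout)
  open import Data.Fin as Fin using (Fin)
  open import Data.Fin.Permutation using (permutation)
  open import Data.Product using (_,_; proj₁; proj₂)
  open import Data.Vec.Functional using (replicate)
  open import Function.Bundles using (Bijection)
  open import Relation.Nullary using (¬_; yes; no; contradiction)
  open import Relation.Binary.Definitions using (Decidable)
  import Relation.Binary.PropositionalEquality as ≡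

  open Field F
  open import Algebra.Properties.Semiring.Mult semiring using (_×_; ×1-homo-*; ×-homo-+)
  open import Algebra.Properties.Semiring.Exp semiring using (_^_)
  open import Algebra.Properties.CommutativeMonoid.Sum +-commutativeMonoid
    using (sum; sum-permute; ∑-distrib-+; sum-replicate; sum-cong-≋)
  open import Relation.Binary.Reasoning.Setoid setoid

  *-cancelʳ-≉0 : ∀ {a x} → ¬ x ≈ 0# → a * x ≈ 0# → a ≈ 0#
  *-cancelʳ-≉0 {a} {x} x≉0 ax≈0 with inverse x x≉0
  ... | y , xy≈1 = begin
    a             ≈⟨ *-identityʳ a ⟨
    a * 1#        ≈⟨ *-congˡ xy≈1 ⟨
    a * (x * y)   ≈⟨ *-assoc a x y ⟨
    (a * x) * y   ≈⟨ *-congʳ ax≈0 ⟩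
    0# * y        ≈⟨ zeroˡ y ⟩
    0#            ∎

  ^-≉0 : ∀ {x} n → ¬ x ≈ 0# → ¬ x ^ n ≈ 0#
  ^-≉0 zero    _   1≈0     = 0≉1 (sym 1≈0)
  ^-≉0 (suc n) x≉0 x^n+1≈0 = ^-≉0 n x≉0 (*-cancelʳ-≉0 x≉0 (trans (*-comm _ _) x^n+1≈0))

  ×1-homo-^ : ∀ m n → (m ℕ.^ n) × 1# ≈ (m × 1#) ^ n
  ×1-homo-^ m zero    = +-identityʳ 1#
  ×1-homo-^ m (suc n) = trans (×1-homo-* m (m ℕ.^ n)) (*-congˡ (×1-homo-^ m n))

  module _ {q} (card : HasCardinality F q) where

    open Bijection card using (to; injective; surjective) renaming (cong to to-cong)

    element : Fin q → Carrier
    element i = proj₁ (surjective i)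

    to-element : ∀ i → to (element i) ≡.≡ i
    to-element i = proj₂ (surjective i) refl

    element-to : ∀ x → element (to x) ≈ x
    element-to x = injective (to-element (to x))

    _≟_ : Decidable _≈_
    x ≟ y with to x Fin.≟ to y
    ... | yes tx≡ty = yes (injective tx≡ty)
    ... | no  tx≢ty = no λ x≈y → tx≢ty (to-cong x≈y)

    translate : Carrier → Fin q → Fin q
    translate a i = to (element i + a)

    translate-cancel : ∀ {a b} → a + b ≈ 0# → ∀ i → translate b (translate a i) ≡.≡ i
    translate-cancel {a} {b} a+b≈0 i = ≡.trans (to-cong (begin
      element (to (element i + a)) + b   ≈⟨ +-congʳ (element-to _) ⟩
      (element i + a) + b                ≈⟨ +-assoc _ _ _ ⟩
      element i + (a + b)                ≈⟨ +-congˡ a+b≈0 ⟩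
      element i + 0#                     ≈⟨ +-identityʳ _ ⟩
      element i                          ∎)) (to-element i)

    -- Translation by 1 permutes the field, so it leaves the sum of all elements unchanged.
    card×1≈0 : q × 1# ≈ 0#
    card×1≈0 = begin
      q × 1#                ≈⟨ +-identityˡ _ ⟨
      0# + q × 1#           ≈⟨ +-congʳ (-‿inverseˡ S) ⟨
      (- S + S) + q × 1#    ≈⟨ +-assoc (- S) S (q × 1#) ⟩
      - S + (S + q × 1#)    ≈⟨ +-congˡ S+q≈S ⟩
      - S + S               ≈⟨ -‿inverseˡ S ⟩
      0#                    ∎
      where
      S = sum element
      S+q≈S : S + q × 1# ≈ S
      S+q≈S = begin
        S + q × 1#                        ≈⟨ +-congˡ (sum-replicate q) ⟨
        S + sum (replicate q 1#)          ≈⟨ ∑-distrib-+ element (replicate q 1#) ⟨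
        sum (λ i → element i + 1#)        ≈⟨ sum-cong-≋ (λ i → element-to (element i + 1#)) ⟨
        sum (λ i → element (translate 1# i)) ≈⟨ sum-permute element
                                                 (permutation (translate 1#) (translate (- 1#))
                                                   (translate-cancel (-‿inverseˡ 1#))
                                                   (translate-cancel (-‿inverseʳ 1#))) ⟨
        S                                 ∎

  module _ {p} (prime : Prime p) where

    private instance
      p≢0 : ℕ.NonZero p
      p≢0 = prime⇒nonZero prime

    characteristic : ∀ n → HasCardinality F (p ℕ.^ n) → p × 1# ≈ 0#
    characteristic n card with _≟_ card (p × 1#) 0#
    ... | yes p≈0 = p≈0
    ... | no  p≉0 = contradiction (trans (sym (×1-homo-^ p n)) (card×1≈0 card)) (^-≉0 n p≉0)

    ×1≈0⇒∣ : p × 1# ≈ 0# → ∀ k → k × 1# ≈ 0# → p ∣ k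
    ×1≈0⇒∣ p≈0 k k≈0 = m%n≡0⇒n∣m k p (residue≡0 (k % p) (m%n<n k p) k%p≈0)
      where
      multiple≈0 : ∀ x {y} → y × 1# ≈ 0# → (x ℕ.* y) × 1# ≈ 0#
      multiple≈0 x {y} y≈0 = trans (×1-homo-* x y) (trans (*-congˡ y≈0) (zeroʳ _))

      k%p≈0 : (k % p) × 1# ≈ 0#
      k%p≈0 = begin
        (k % p) × 1#                                   ≈⟨ +-identityʳ _ ⟨
        (k % p) × 1# + 0#                              ≈⟨ +-congˡ (multiple≈0 (k / p) p≈0) ⟨
        (k % p) × 1# + (k / p ℕ.* p) × 1#              ≈⟨ ×-homo-+ 1# (k % p) (k / p ℕ.* p) ⟨
        (k % p ℕ.+ k / p ℕ.* p) × 1#                   ≡⟨ ≡.cong (_× 1#) (≡.sym (m≡m%n+[m/n]*n k p)) ⟩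
        k × 1#                                         ≈⟨ k≈0 ⟩
        0#                                             ∎

      1+a≢b : ∀ {a b} → a × 1# ≈ 0# → b × 1# ≈ 0# → ¬ suc a ≡.≡ b
      1+a≢b {a} {b} a≈0 b≈0 1+a≡b = 0≉1 (begin
        0#            ≈⟨ b≈0 ⟨
        b × 1#        ≡⟨ ≡.cong (_× 1#) 1+a≡b ⟨
        1# + a × 1#   ≈⟨ +-congˡ a≈0 ⟩
        1# + 0#       ≈⟨ +-identityʳ 1# ⟩
        1#            ∎)

      -- A nonzero residue r is invertible mod p, and a Bézout relation 1 + a = b
      -- between multiples of p and r would give 1 = 0.
      residue≡0 : ∀ r → r ℕ.< p → r × 1# ≈ 0# → r ≡.≡ 0
      residue≡0 zero      _   _   = ≡.refl
      residue≡0 r@(suc _) r<p r≈0 with coprime-Bézout (prime⇒coprime prime r<p)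
      ... | Bézout.+- x y eq = contradiction eq (1+a≢b (multiple≈0 y r≈0) (multiple≈0 x p≈0))
      ... | Bézout.-+ x y eq = contradiction eq (1+a≢b (multiple≈0 x p≈0) (multiple≈0 y r≈0))

open import Level using (Level)
open import Data.Nat using (ℕ; _≤_; _<_; _^_; _∸_)
open import Data.Nat.Primality using (Prime; prime⇒nonZero)
open import Function.Bundles using (_⇔_)

module KernelSpan {c ℓ} (F : Field c ℓ) {p n m : ℕ} (prime : Prime p) (2≤n : 2 ≤ n) (m<p : m < p)
                  (card : HasCardinality F (p ^ n)) where

  open Arithmetic using (rising; ¬p∣rising-residue; <⇒≤∸1; <∸1⇒suc<)
  open import Data.Nat as ℕ using (ℕ; zero; suc; _≤_; _<_; _∸_; z≤n; s≤s)
  import Data.Nat.Properties as ℕ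
  open import Data.Nat.DivMod using (_%_; _/_; m≡m%n+[m/n]*n)
  open import Data.Nat.Primality using (Prime; prime⇒nonZero; prime⇒nonTrivial)
  open import Data.List using (List; map; concatMap; upTo)
  open import Data.List.Membership.Propositional using (_∈_; find; lose)
  open import Data.List.Membership.Propositional.Properties
    using (∈-++⁻; ∈-++⁺ˡ; ∈-++⁺ʳ; ∈-concatMap⁺; ∈-concatMap⁻; ∈-map⁻; ∈-map⁺; ∈-upTo⁺; ∈-upTo⁻)
  open import Data.Product using (_,_)
  open import Data.Sum using (inj₁; inj₂)
  open import Function.Bundles using (_⇔_; mk⇔)
  open import Relation.Nullary using (¬_; yes; no; contradiction)
  import Relation.Binary.PropositionalEquality as ≡

  open Field F
  open Poly commutativeRing
  open PolynomialAlgebra commutativeRing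
  open FiniteField F
  open import Algebra.Properties.Semiring.Mult semiring using (_×_)

  private instance
    p≢0 : ℕ.NonZero p
    p≢0 = prime⇒nonZero prime

  p×1≈0 : p × 1# ≈ 0#
  p×1≈0 = characteristic prime n card

  open CharacteristicP prime p×1≈0

  q N : ℕ
  q = p ℕ.^ n
  N = p ℕ.^ (n ∸ 1)

  2≤p : 2 ≤ p
  2≤p = ℕ.nonTrivial⇒n>1 p {{prime⇒nonTrivial prime}}

  q≡p*N : q ≡.≡ p ℕ.* N
  q≡p*N = split (ℕ.≤-trans (s≤s z≤n) 2≤n)
    where
    split : ∀ {n} → 1 ≤ n → p ℕ.^ n ≡.≡ p ℕ.* p ℕ.^ (n ∸ 1)
    split (s≤s _) = ≡.refl

  2≤N : 2 ≤ N
  2≤N = bound 2≤n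
    where
    bound : ∀ {n} → 2 ≤ n → 2 ≤ p ℕ.^ (n ∸ 1)
    bound (s≤s (s≤s {n = k} _)) = ℕ.≤-trans 2≤p (ℕ.m≤m*n p (p ℕ.^ k) {{ℕ.m^n≢0 p k}})

  Aᵐ : Pol → Pol
  Aᵐ = iter m opAmI

  Aᵐ-isLinear : IsLinear Aᵐ
  Aᵐ-isLinear = iter-isLinear opAmI-isLinear m

  record Ker< (d : ℕ) (f : Pol) : Set ℓ where
    field
      coeff₀≈0 : coeff f 0 ≈ 0#
      degree   : Deg< f d
      killed   : IsZero (Aᵐ f)
  open Ker<

  Ker<-mono : ∀ {d d′ f} → d ≤ d′ → Ker< d f → Ker< d′ f
  Ker<-mono d≤d′ f∈K = record
    { coeff₀≈0 = coeff₀≈0 f∈K ; degree = Deg<-mono d≤d′ (degree f∈K) ; killed = killed f∈K }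

  Ker<-isSubspace : ∀ d → IsSubspace (Ker< d)
  Ker<-isSubspace d = record
    { zero-closed  = record
      { coeff₀≈0 = refl ; degree = deg< (λ _ _ → refl) ; killed = zero-homo ≋-refl }
    ; ⊕-closed     = λ {f} {g} f∈K g∈K → record
      { coeff₀≈0 = trans (coeff-⊕ f g 0) (trans (+-cong (coeff₀≈0 f∈K) (coeff₀≈0 g∈K)) (+-identityʳ 0#))
      ; degree   = deg< λ k d≤k → trans (coeff-⊕ f g k)
                     (trans (+-cong (vanish (degree f∈K) k d≤k) (vanish (degree g∈K) k d≤k)) (+-identityʳ 0#))
      ; killed   = ≋-trans (⊕-homo f g) (≋-trans (⊕-identityˡ _ (killed f∈K)) (killed g∈K))
      }
    ; scale-closed = λ a {f} f∈K → record
      { coeff₀≈0 = trans (coeff-scale a f 0) (trans (*-congˡ (coeff₀≈0 f∈K)) (zeroʳ a))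
      ; degree   = deg< λ k d≤k → trans (coeff-scale a f k)
                     (trans (*-congˡ (vanish (degree f∈K) k d≤k)) (zeroʳ a))
      ; killed   = ≋-trans (scale-homo a f) (scale-zero a (killed f∈K))
      }
    ; cong         = λ f≋g f∈K → record
      { coeff₀≈0 = trans (sym (at f≋g 0)) (coeff₀≈0 f∈K)
      ; degree   = Deg<-cong f≋g (degree f∈K)
      ; killed   = ≋-trans (IsLinear.cong Aᵐ-isLinear (≋-sym f≋g)) (killed f∈K)
      }
    }
    where open IsLinear Aᵐ-isLinear using (zero-homo; ⊕-homo; scale-homo)

  gens : List Pol
  gens = generators p n m

  G : ℕ → ℕ → Pol
  G r s = pow X r ⊗ pow (pow X p ⊖ X) (suc s)

  G-leading : ∀ r s → Leading (G r s) (r ℕ.+ p ℕ.* suc s) 1#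
  G-leading r s = Leading-cong (*-identityˡ 1#)
    (Leading-⊗ (Leading-X^ r) (Leading-pow (suc s) (Leading-X^-X p 2≤p)))

  G-Ker< : ∀ {r} s → r < m → Ker< (suc (r ℕ.+ p ℕ.* suc s)) (G r s)
  G-Ker< {r} s r<m = record
    { coeff₀≈0 = trans (coeff₀-⊗ (pow X r) (pow T (suc s))) (trans (*-congˡ T^s+1₀≈0) (zeroʳ _))
    ; degree   = below (G-leading r s)
    ; killed   = X^⊗T^-in-kernel m r s r<m
    }
    where
    T = pow X p ⊖ X
    T^s+1₀≈0 : coeff (pow T (suc s)) 0 ≈ 0#
    T^s+1₀≈0 = trans (coeff₀-⊗ T (pow T s))
      (trans (*-congʳ (coeff₀-X^-X p (ℕ.≤-trans (s≤s z≤n) 2≤p))) (zeroˡ _))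

  X^-Ker< : ∀ {k} → k < m → Ker< (2 ℕ.+ k) (pow X (suc k))
  X^-Ker< {k} k<m = record
    { coeff₀≈0 = coeff-X^ (suc k) 0 ; degree = below (Leading-X^ (suc k)) ; killed = X^-in-kernel m k k<m }

  G-degree< : ∀ {r s} → r < m → s < N ∸ 1 → suc (r ℕ.+ p ℕ.* suc s) ≤ q ∸ 1
  G-degree< {r} {s} r<m s<N-1 = <⇒≤∸1 (begin
    2 ℕ.+ r ℕ.+ p ℕ.* suc s    ≤⟨ ℕ.+-monoˡ-≤ (p ℕ.* suc s) (ℕ.≤-trans (s≤s r<m) m<p) ⟩
    p ℕ.+ p ℕ.* suc s          ≡⟨ ℕ.*-suc p (suc s) ⟨
    p ℕ.* suc (suc s)          ≤⟨ ℕ.*-monoʳ-≤ p (<∸1⇒suc< s<N-1) ⟩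
    p ℕ.* N                    ≡⟨ q≡p*N ⟨
    q                          ∎)
    where open ℕ.≤-Reasoning

  X^-degree< : ∀ {k} → k < m → 2 ℕ.+ k ≤ q ∸ 1
  X^-degree< {k} k<m = <⇒≤∸1 (begin
    3 ℕ.+ k       ≤⟨ s≤s (s≤s k<m) ⟩
    2 ℕ.+ m       ≤⟨ ℕ.+-monoʳ-≤ 1 m<p ⟩
    1 ℕ.+ p       ≤⟨ ℕ.+-monoˡ-≤ p (ℕ.≤-trans (s≤s z≤n) 2≤p) ⟩
    p ℕ.+ p       ≡⟨ ≡.cong (p ℕ.+_) (ℕ.*-identityʳ p) ⟨
    p ℕ.+ p ℕ.* 1 ≡⟨ ℕ.*-suc p 1 ⟨
    p ℕ.* 2       ≤⟨ ℕ.*-monoʳ-≤ p 2≤N ⟩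
    p ℕ.* N       ≡⟨ q≡p*N ⟨
    q             ∎)
    where open ℕ.≤-Reasoning

  Gs : ℕ → List Pol
  Gs r = map (G r) (upTo (N ∸ 1))

  G∈gens : ∀ {r s} → r < m → s < N ∸ 1 → G r s ∈ gens
  G∈gens {r} r<m s<N-1 = ∈-++⁺ˡ (∈-concatMap⁺ Gs (lose (∈-upTo⁺ r<m) (∈-map⁺ (G r) (∈-upTo⁺ s<N-1))))

  X^∈gens : ∀ {k} → k < m → pow X (suc k) ∈ gens
  X^∈gens k<m = ∈-++⁺ʳ _ (∈-map⁺ (λ k → pow X (suc k)) (∈-upTo⁺ k<m))

  gens-Ker< : ∀ {g} → g ∈ gens → Ker< (q ∸ 1) g
  gens-Ker< g∈gens with ∈-++⁻ (concatMap Gs (upTo m)) g∈gens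
  ... | inj₁ g∈Gs with find (∈-concatMap⁻ Gs g∈Gs)
  ...   | r , r∈ , g∈Gr with ∈-map⁻ (G r) g∈Gr
  ...     | s , s∈ , ≡.refl = Ker<-mono (G-degree< (∈-upTo⁻ r∈) (∈-upTo⁻ s∈)) (G-Ker< s (∈-upTo⁻ r∈))
  gens-Ker< g∈gens | inj₂ g∈Xs with ∈-map⁻ (λ k → pow X (suc k)) g∈Xs
  ... | k , k∈ , ≡.refl = Ker<-mono (X^-degree< (∈-upTo⁻ k∈)) (X^-Ker< (∈-upTo⁻ k∈))

  Ker<-lower : ∀ {D f} → Ker< (suc D) f → coeff f D ≈ 0# → Ker< D f
  Ker<-lower f∈K f_D≈0 = record
    { coeff₀≈0 = coeff₀≈0 f∈K ; degree = Deg<-lower (degree f∈K) f_D≈0 ; killed = killed f∈K }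

  top-vanishes : ∀ {D f} → m < D → m ≤ D % p → Ker< (suc D) f → Ker< D f
  top-vanishes {D} {f} m<D m≤r f∈K = Ker<-lower f∈K top≈0
    where
    e = D ∸ suc m
    D≡m+1+e : D ≡.≡ m ℕ.+ suc e
    D≡m+1+e = ≡.trans (≡.sym (ℕ.m+[n∸m]≡n m<D)) (≡.sym (ℕ.+-suc m e))
    lead : Leading (Aᵐ f) (suc e) ((rising (2 ℕ.+ e) m × 1#) * coeff f D)
    lead = opAmI^-leading m e f
      (≡.subst (λ d → Leading f d (coeff f D)) D≡m+1+e (leading (degree f∈K) refl))
    rising≉0 : ¬ rising (2 ℕ.+ e) m × 1# ≈ 0#
    rising≉0 r≈0 = ¬p∣rising-residue prime m e (≡.subst (λ d → m ≤ d % p) D≡m+1+e m≤r)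
                     (×1≈0⇒∣ prime p×1≈0 _ r≈0)
    top≈0 : coeff f D ≈ 0#
    top≈0 = *-cancelʳ-≉0 rising≉0 (trans (*-comm _ _) (trans (sym (top lead)) (at (killed f∈K) (suc e))))

  peel : ∀ {D f g} → Leading g D 1# → Ker< (suc D) g → Ker< (suc D) f →
         Ker< D (f ⊖ scale (coeff f D) g)
  peel {D} {f} {g} g-lead g∈K f∈K = Ker<-lower (⊖-scale-closed a f∈K g∈K) (begin
    coeff (f ⊖ scale a g) D          ≈⟨ coeff-⊖ f (scale a g) D ⟩
    a - coeff (scale a g) D          ≈⟨ +-congˡ (-‿cong (trans (coeff-scale a g D) (*-congˡ (top g-lead)))) ⟩
    a - a * 1#                       ≈⟨ +-congˡ (-‿cong (*-identityʳ a)) ⟩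
    a - a                            ≈⟨ -‿inverseʳ a ⟩
    0#                               ∎)
    where
    open IsSubspace (Ker<-isSubspace (suc D)) using (⊖-scale-closed)
    open import Relation.Binary.Reasoning.Setoid setoid
    a = coeff f D

  module _ where
    open IsSubspace (InSpan-isSubspace gens)

    peel-span : ∀ {D f g} → Leading g D 1# → Ker< (suc D) g → g ∈ gens → Ker< (suc D) f →
                (∀ {h} → Ker< D h → InSpan gens h) → InSpan gens f
    peel-span {D} {f} {g} g-lead g∈K g∈gens f∈K spanned-below =
      cong (⊖-⊕-cancel f (scale a g))
        (⊕-closed {f ⊖ scale a g} (spanned-below (peel g-lead g∈K f∈K)) (scale-closed a {g} (InSpan-∈ g∈gens)))
      where a = coeff f D

    reduce : ∀ k {f} → 2 ℕ.+ k ≤ q ∸ 1 → Ker< (2 ℕ.+ k) f →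
             (∀ {g} → Ker< (suc k) g → InSpan gens g) → InSpan gens f
    reduce k {f} 2+k≤q-1 f∈K spanned-below with suc k ℕ.≤? m
    ... | yes 1+k≤m = peel-span (Leading-X^ (suc k)) (X^-Ker< 1+k≤m) (X^∈gens 1+k≤m) f∈K spanned-below
    ... | no  1+k≰m with m ℕ.≤? suc k % p
    ...   | yes m≤r = spanned-below (top-vanishes (ℕ.≰⇒> 1+k≰m) m≤r f∈K)
    ...   | no  m≰r = by-quotient (suc k / p) (m≡m%n+[m/n]*n (suc k) p)
      where
      r = suc k % p
      r<m = ℕ.≰⇒> m≰r
      by-quotient : ∀ t → suc k ≡.≡ r ℕ.+ t ℕ.* p → InSpan gens f
      by-quotient zero    1+k≡r = contradiction
        (ℕ.≤-trans (ℕ.≤-reflexive (≡.trans 1+k≡r (ℕ.+-identityʳ r))) (ℕ.<⇒≤ r<m)) 1+k≰m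
      by-quotient (suc s) 1+k≡r+tp = peel-span (≡.subst (λ d → Leading (G r s) d 1#) r+p[1+s]≡1+k (G-leading r s))
                                   (≡.subst (λ d → Ker< (suc d) (G r s)) r+p[1+s]≡1+k (G-Ker< s r<m))
                                   (G∈gens r<m s<N-1) f∈K spanned-below
        where
        r+p[1+s]≡1+k : r ℕ.+ p ℕ.* suc s ≡.≡ suc k
        r+p[1+s]≡1+k = ≡.trans (≡.cong (r ℕ.+_) (ℕ.*-comm p (suc s))) (≡.sym 1+k≡r+tp)
        s<N-1 : s < N ∸ 1
        s<N-1 = <⇒≤∸1 (ℕ.*-cancelˡ-< p (suc s) N (begin-strict
          p ℕ.* suc s              ≤⟨ ℕ.m≤n+m _ r ⟩
          r ℕ.+ p ℕ.* suc s        ≡⟨ r+p[1+s]≡1+k ⟩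
          suc k                    <⟨ ℕ.≤-trans 2+k≤q-1 (ℕ.m∸n≤m q 1) ⟩
          q                        ≡⟨ q≡p*N ⟩
          p ℕ.* N                  ∎))
          where open ℕ.≤-Reasoning

    spanned : ∀ d {f} → d ≤ q ∸ 1 → Ker< d f → InSpan gens f
    spanned zero          _   f∈K = cong (≋-sym (Deg<0⇒IsZero (degree f∈K))) zero-closed
    spanned (suc zero)    _   f∈K = cong (≋-sym (Deg<1⇒IsZero (coeff₀≈0 f∈K) (degree f∈K))) zero-closed
    spanned (suc (suc k)) d≤q f∈K = reduce k d≤q f∈K (spanned (suc k) (ℕ.≤-trans (ℕ.n≤1+n _) d≤q))

  InKer⇒Ker< : ∀ {f} → InKer q m f → Ker< (q ∸ 1) f
  InKer⇒Ker< ((f₀≈0 , f<q) , killed) = record { coeff₀≈0 = f₀≈0 ; degree = deg< f<q ; killed = mk≋ killed }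

  Ker<⇒InKer : ∀ {f} → Ker< (q ∸ 1) f → InKer q m f
  Ker<⇒InKer f∈K = (coeff₀≈0 f∈K , vanish (degree f∈K)) , at (killed f∈K)

  kernel⇔span : ∀ f → InKer q m f ⇔ InSpan gens f
  kernel⇔span f = mk⇔
    (λ f∈ker → spanned (q ∸ 1) ℕ.≤-refl (InKer⇒Ker< f∈ker))
    (λ (c , f≃) → Ker<⇒InKer (IsSubspace.cong (Ker<-isSubspace (q ∸ 1)) (≋-sym (mk≋ {f} {linComb gens c} f≃))
                                 (linComb-closed (Ker<-isSubspace (q ∸ 1)) gens gens-Ker< c)))

-- The case m = 0 also holds (both sides are {0}).
theorem1 : ∀ {c ℓ : Level} (p n m : ℕ) → Prime p → 2 ≤ n → 1 ≤ m → m ≤ p ∸ 1 →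
    (F : Field c ℓ) → HasCardinality F (p ^ n) →
    let open Poly (Field.commutativeRing F) in
    ∀ (f : Pol) → (InKer (p ^ n) m f ⇔ InSpan (generators p n m) f)
theorem1 p n m p-prime 2≤n _ m≤p-1 F card =
  KernelSpan.kernel⇔span F p-prime 2≤n (≤∸1⇒< {{prime⇒nonZero p-prime}} m≤p-1) card
  where open Arithmetic using (≤∸1⇒<)
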